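{- Let $(G,*)$ be a groupoid satisfying the identities (i) $xy\approx yx$ and (ii) $((wx)y)z\approx((wx)z)y$. Then $s_n(*)\le F_{n+1}-1$ and $s^{ac}_n(*)\le B_{n,2}-1$ for $n=2,3,\dots$; the first inequality holds as an equality whenever the second does. Moreover, both upper bounds are reached by the 3-element groupoids $\mathrm{SC}79$ (rows $0{:}\ 0\,0\,0$; $1{:}\ 0\,1\,0$; $2{:}\ 0\,0\,1$) and $\mathrm{SC}1701$ (rows $0{:}\ 0\,1\,1$; $1{:}\ 1\,0\,0$; $2{:}\ 1\,0\,1$).
   Context: A groupoid $(G,*)$ is a set with a binary operation; $xy$ denotes $x*y$. $\mathcal B_n$ is the set of bracketings of the word $x_1x_2\cdots x_n$ (all ways to insert parentheses), and $\mathcal F_n$ is the set of full linear terms, obtained from bracketings by permuting the variables. Each such term $t$ induces an $n$-ary operation $t^*$ on $G$. The associative spectrum is $s_n(*):=|\{t^*:t\in\mathcal B_n\}|$ and the associative-commutative spectrum is $s^{ac}_n(*):=|\{t^*:t\in\mathcal F_n\}|$. A groupoid satisfies an identity if both sides take equal values under every assignment of elements of $G$ to the variables. $F_n$ is the Fibonacci number ($F_0=0$, $F_1=1$, $F_{n+1}=F_n+F_{n-1}$). $B_{n,2}$ is the number of partitions of $\{1,\dots,n\}$ into unordered nonempty blocks of size at most $2$. A 3-element groupoid on $\{0,1,2\}$ is given by its Cayley table; "row $a{:}\ p\,q\,r$" means $a*0=p$, $a*1=q$, $a*2=r$. -}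

module Defs where

open import Data.Nat using (ℕ; zero; suc; _+_; _*_)
open import Data.Fin using (Fin; zero; suc)
open import Data.List using (List; []; _∷_; _++_; allFin)
open import Data.Vec using (Vec; lookup)
open import Data.Vec.Relation.Unary.All using (All)
open import Data.Product using (Σ; ∃; _×_)
open import Relation.Binary.PropositionalEquality using (_≡_; _≢_)
open import Data.List.Relation.Binary.Permutation.Propositional using (_↭_)
open import Relation.Nullary using (¬_)

-- Terms in the variables x_1 ... x_n (variable x_{i+1} is  var i).
data Term (n : ℕ) : Set where
  var : Fin n → Term n
  _·_ : Term n → Term n → Term n

leaves : ∀ {n} → Term n → List (Fin n)
leaves (var i) = i ∷ []
leaves (s · t) = leaves s ++ leaves t

IsBracketing : ∀ {n} → Term n → Set
IsBracketing {n} t = leaves t ≡ allFin n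

IsFullLinear : ∀ {n} → Term n → Set
IsFullLinear {n} t = leaves t ↭ allFin n

eval : ∀ {n} {G : Set} → (G → G → G) → (Fin n → G) → Term n → G
eval _∙_ ρ (var i) = ρ i
eval _∙_ ρ (s · t) = eval _∙_ ρ s ∙ eval _∙_ ρ t

SameOp : ∀ {n} {G : Set} → (G → G → G) → Term n → Term n → Set
SameOp _∙_ s t = ∀ ρ → eval _∙_ ρ s ≡ eval _∙_ ρ t

-- |{ t^* : P t }| ≤ k : k terms of the family whose operations cover all of them
SpecLe : {G : Set} → (G → G → G) → (n : ℕ) → (Term n → Set) → ℕ → Set
SpecLe _∙_ n P k =
  Σ (Vec (Term n) k) λ v → All P v ×
    (∀ t → P t → ∃ λ i → SameOp _∙_ t (lookup v i))

-- |{ t^* : P t }| ≥ k : k terms of the family with pairwise distinct operations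
SpecGe : {G : Set} → (G → G → G) → (n : ℕ) → (Term n → Set) → ℕ → Set
SpecGe _∙_ n P k =
  Σ (Vec (Term n) k) λ v → All P v ×
    (∀ i j → i ≢ j → ¬ SameOp _∙_ (lookup v i) (lookup v j))

SpecEq : {G : Set} → (G → G → G) → (n : ℕ) → (Term n → Set) → ℕ → Set
SpecEq _∙_ n P k = SpecLe _∙_ n P k × SpecGe _∙_ n P k

fib : ℕ → ℕ
fib 0 = 0
fib 1 = 1
fib (suc (suc n)) = fib (suc n) + fib n

-- B_{n,2}: partitions of {1..n} into blocks of size ≤ 2 (standard recurrence:
-- element n+2 is a singleton, or paired with one of the other n+1 elements)
B2 : ℕ → ℕ
B2 0 = 1
B2 1 = 1
B2 (suc (suc n)) = B2 (suc n) + suc n * B2 n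

Commutative : {G : Set} → (G → G → G) → Set
Commutative _∙_ = ∀ x y → x ∙ y ≡ y ∙ x

Ident-ii : {G : Set} → (G → G → G) → Set
Ident-ii _∙_ = ∀ w x y z → ((w ∙ x) ∙ y) ∙ z ≡ ((w ∙ x) ∙ z) ∙ y

sc79 : Fin 3 → Fin 3 → Fin 3
sc79 (suc zero) (suc zero) = suc zero
sc79 (suc (suc zero)) (suc (suc zero)) = suc zero
sc79 _ _ = zero

sc1701 : Fin 3 → Fin 3 → Fin 3
sc1701 zero zero = zero
sc1701 zero _ = suc zero
sc1701 (suc zero) zero = suc zero
sc1701 (suc zero) _ = zero
sc1701 (suc (suc zero)) zero = suc zero
sc1701 (suc (suc zero)) (suc zero) = zero
sc1701 (suc (suc zero)) (suc (suc zero)) = suc zero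

module Submission where

-- Under (i) and (ii) every term in at least two variables equals a left comb
-- ((x_a x_b) B₁) ⋯ Bₖ whose factors Bᵢ are variables or products of two variables, and its
-- value depends only on the multiset of blocks {x_a x_b, B₁, …, Bₖ}. For a full linear term
-- the blocks partition the variables into blocks of size at most 2, at least one of them a
-- pair; for a bracketing every pair consists of consecutive variables. There are B_{n,2} - 1,
-- resp. F_{n+1} - 1, such partitions, which gives the upper bounds. In SC79 and SC1701 the
-- valuation sending x_a and x_b to 2 and all other variables to 1, resp. 0, detects whether
-- {a, b} is a block, so distinct partitions give distinct operations. Finally, if the full
-- linear bound is attained then the canonical full linear terms have pairwise distinct
-- operations, and the canonical bracketings are among them.

open import Defs
open import Data.Nat using (ℕ; zero; suc; _+_; _*_; _∸_; _≤_; s≤s)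
open import Data.Nat.Properties using (*-identityˡ; +-suc; +-cancelˡ-≡; n<1+n)
open import Data.Fin using (Fin; zero; suc; toℕ; punchIn; punchOut)
open import Data.Fin.Patterns using (0F; 1F; 2F)
open import Data.Fin.Properties
  using (_≟_; _≤?_; ≤-antisym; ≤-total; suc-injective; all?; any?; pigeonhole; <-irrefl;
         +↔⊎; *↔×; punchIn-injective; punchInᵢ≢i; punchIn-punchOut; punchOut-injective)
open import Data.List using (List; []; _∷_; _++_; [_]; map; foldl; foldr; allFin)
open import Data.Bool using (Bool; true; false; _xor_)
open import Data.Bool.Properties using (xor-assoc; xor-identityʳ; xor-∧-commutativeRing)
open import Algebra.Bundles using (CommutativeRing)
open import Data.List.Properties
  using (map-++; foldl-++; map-cong; map-∘; map-id; map-tabulate; ++-identityʳ; ++-assoc)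
open import Data.List.Relation.Binary.Permutation.Propositional as ↭
  using (_↭_; prep; swap; ↭-refl; ↭-sym; ↭-trans; ↭-reflexive; ↭⇒↭ₛ; module PermutationReasoning)
open import Data.List.Relation.Binary.Permutation.Propositional.Properties
  using (drop-∷; shift; map⁺; ∈-resp-↭; Any-resp-↭; All-resp-↭; ++-comm; ++⁺; ++⁺ˡ; ++⁺ʳ;
         ↭-empty-inv; ↭-length)
open import Data.List.Membership.Propositional using (_∈_; _∉_)
open import Data.List.Membership.Propositional.Properties
  using (∈-∃++; ∈-++⁻; ∈-++⁺ˡ; ∈-++⁺ʳ; ∈-map⁺; ∈-map⁻; ∈-allFin)
open import Data.List.Relation.Unary.Unique.Propositional using (Unique)
open import Data.List.Relation.Unary.Unique.Propositional.Properties using (allFin⁺)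
import Data.List.Relation.Binary.Permutation.Setoid.Properties as PermProps
open import Data.List.Relation.Unary.Any using (Any; here; there)
import Data.List.Relation.Unary.Any as Any
import Data.List.Relation.Unary.Any.Properties as Any
open import Data.List.Relation.Unary.All using (All; []; _∷_)
open import Data.List.Relation.Unary.AllPairs using ([]; _∷_)
import Data.List.Relation.Unary.All as All
import Data.List.Relation.Unary.All.Properties as All
open import Data.List.Relation.Unary.Linked using (Linked; []; [-]; _∷_)
import Data.List.Relation.Unary.Linked as Linked
import Data.List.Relation.Unary.Linked.Properties as Linked
open import Data.Product using (Σ; ∃; _×_; _,_; proj₁; proj₂)
import Data.Product as Product
open import Data.Product.Function.NonDependent.Propositional using (_×-↔_)
open import Data.Sum using (_⊎_; inj₁; inj₂; [_,_]′)
import Data.Sum as Sum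
open import Data.Sum.Function.Propositional using (_⊎-↔_)
open import Data.Empty using (⊥; ⊥-elim)
open import Data.Unit using (⊤; tt)
open import Data.Vec using (Vec; tabulate; lookup)
open import Data.Vec.Properties using (lookup∘tabulate)
import Data.Vec.Relation.Unary.All as VAll
import Data.Vec.Relation.Unary.All.Properties as VAll
open import Function using (_∘_; id; case_of_)
open import Function.Bundles using (_↔_; Inverse; mk↔ₛ′)
open import Function.Properties.Inverse using (↔-refl; ↔-sym; ↔-trans)
open import Relation.Nullary using (¬_; yes; no)
open import Relation.Nullary.Decidable using (toWitness; ¬?; decidable-stable)
open import Relation.Binary.PropositionalEquality hiding ([_])

data Block (n : ℕ) : Set where
  single : Fin n → Block n
  pair   : Fin n → Fin n → Block n

blockVars : ∀ {n} → Block n → List (Fin n)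
blockVars (single i) = [ i ]
blockVars (pair i j) = i ∷ j ∷ []

vars : ∀ {n} → List (Block n) → List (Fin n)
vars []      = []
vars (x ∷ L) = blockVars x ++ vars L

relabel : ∀ {n m} → (Fin n → Fin m) → Block n → Block m
relabel f (single i) = single (f i)
relabel f (pair i j) = pair (f i) (f j)

IsPair : ∀ {n} → Block n → Set
IsPair (single _) = ⊥
IsPair (pair _ _) = ⊤

orient : ∀ {n} → Block n → Block n
orient (single i) = single i
orient (pair i j) with i ≤? j
... | yes _ = pair i j
... | no  _ = pair j i

SameBlocks : ∀ {n} → List (Block n) → List (Block n) → Set
SameBlocks L M = map orient L ↭ map orient M

-- node a b L stands for the left comb ((x_a x_b) B₁) ⋯ Bₖ, where B₁ … Bₖ are the
-- blocks of L read as x_i or x_i x_j.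
data Flat (n : ℕ) : Set where
  leaf : Fin n → Flat n
  node : Fin n → Fin n → List (Block n) → Flat n

infixl 6 _⊗_
_⊗_ : ∀ {n} → Flat n → Flat n → Flat n
leaf i     ⊗ leaf j     = node i j []
leaf i     ⊗ node a b L = node a b (L ++ [ single i ])
node a b L ⊗ leaf j     = node a b (L ++ [ single j ])
node a b L ⊗ node c d M = node a b (L ++ pair c d ∷ M)

flatten : ∀ {n} → Term n → Flat n
flatten (var i) = leaf i
flatten (s · t) = flatten s ⊗ flatten t

blocksOf : ∀ {n} → Flat n → List (Block n)
blocksOf (leaf i)     = [ single i ]
blocksOf (node a b L) = pair a b ∷ L

module _ {G : Set} (_∙_ : G → G → G) {n : ℕ} (ρ : Fin n → G) where

  evalBlock : Block n → G
  evalBlock (single i) = ρ i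
  evalBlock (pair i j) = ρ i ∙ ρ j

  evalFlat : Flat n → G
  evalFlat (leaf i)     = ρ i
  evalFlat (node a b L) = foldl _∙_ (ρ a ∙ ρ b) (map evalBlock L)

module Normalization {G : Set} {_∙_ : G → G → G}
                     (comm : Commutative _∙_) (ii : Ident-ii _∙_) where

  ∙-foldl-absorb : ∀ p c d xs → p ∙ foldl _∙_ (c ∙ d) xs ≡ foldl _∙_ (p ∙ (c ∙ d)) xs
  ∙-foldl-absorb p c d []       = refl
  ∙-foldl-absorb p c d (x ∷ xs) = begin
    p ∙ foldl _∙_ ((c ∙ d) ∙ x) xs    ≡⟨ ∙-foldl-absorb p (c ∙ d) x xs ⟩
    foldl _∙_ (p ∙ ((c ∙ d) ∙ x)) xs  ≡⟨ cong (λ z → foldl _∙_ z xs) step ⟩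
    foldl _∙_ ((p ∙ (c ∙ d)) ∙ x) xs  ∎
    where
    open ≡-Reasoning
    step : p ∙ ((c ∙ d) ∙ x) ≡ (p ∙ (c ∙ d)) ∙ x
    step = begin
      p ∙ ((c ∙ d) ∙ x)  ≡⟨ comm p _ ⟩
      ((c ∙ d) ∙ x) ∙ p  ≡⟨ ii c d x p ⟩
      ((c ∙ d) ∙ p) ∙ x  ≡⟨ cong (_∙ x) (comm (c ∙ d) p) ⟩
      (p ∙ (c ∙ d)) ∙ x  ∎

  foldl-↭ : ∀ a b {xs ys} → xs ↭ ys → foldl _∙_ (a ∙ b) xs ≡ foldl _∙_ (a ∙ b) ys
  foldl-↭ a b ↭.refl                   = refl
  foldl-↭ a b (prep x p)               = foldl-↭ (a ∙ b) x p
  foldl-↭ a b (swap {xs = xs} x y p)   =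
    trans (cong (λ z → foldl _∙_ z xs) (ii a b x y)) (foldl-↭ ((a ∙ b) ∙ y) x p)
  foldl-↭ a b (↭.trans p q)            = trans (foldl-↭ a b p) (foldl-↭ a b q)

  foldl-∙-↭ : ∀ a b c d {xs ys} → (a ∙ b) ∷ xs ↭ (c ∙ d) ∷ ys →
              foldl _∙_ (a ∙ b) xs ≡ foldl _∙_ (c ∙ d) ys
  foldl-∙-↭ a b c d {xs} {ys} p with ∈-resp-↭ p (here refl)
  ... | here ab≡cd = begin
    foldl _∙_ (a ∙ b) xs  ≡⟨ foldl-↭ a b (drop-∷ (subst (λ z → (a ∙ b) ∷ xs ↭ z ∷ ys) (sym ab≡cd) p)) ⟩
    foldl _∙_ (a ∙ b) ys  ≡⟨ cong (λ z → foldl _∙_ z ys) ab≡cd ⟩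
    foldl _∙_ (c ∙ d) ys  ∎
    where open ≡-Reasoning
  ... | there ab∈ys with ∈-∃++ ab∈ys
  ... | A , B , refl = begin
    foldl _∙_ (a ∙ b) xs                     ≡⟨ foldl-↭ a b xs↭ ⟩
    foldl _∙_ ((a ∙ b) ∙ (c ∙ d)) (A ++ B)   ≡⟨ cong (λ z → foldl _∙_ z (A ++ B)) (comm _ _) ⟩
    foldl _∙_ ((c ∙ d) ∙ (a ∙ b)) (A ++ B)   ≡⟨ foldl-↭ c d (↭-sym (shift (a ∙ b) A B)) ⟩
    foldl _∙_ (c ∙ d) (A ++ (a ∙ b) ∷ B)     ∎
    where
    open ≡-Reasoning
    xs↭ : xs ↭ (c ∙ d) ∷ A ++ B
    xs↭ = drop-∷ (↭-trans p (↭-trans (prep (c ∙ d) (shift (a ∙ b) A B)) (swap (c ∙ d) (a ∙ b) ↭-refl)))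

  module _ {n : ℕ} (ρ : Fin n → G) where

    private
      ⟦_⟧ᵇ : Block n → G
      ⟦_⟧ᵇ = evalBlock _∙_ ρ

      ⟦_⟧ : Flat n → G
      ⟦_⟧ = evalFlat _∙_ ρ

    foldl-snoc : ∀ h L x →
                 foldl _∙_ h (map ⟦_⟧ᵇ (L ++ [ x ])) ≡ foldl _∙_ h (map ⟦_⟧ᵇ L) ∙ ⟦ x ⟧ᵇ
    foldl-snoc h L x = trans (cong (foldl _∙_ h) (map-++ ⟦_⟧ᵇ L [ x ])) (foldl-++ _∙_ h (map ⟦_⟧ᵇ L) _)

    eval-⊗ : ∀ x y → ⟦ x ⟧ ∙ ⟦ y ⟧ ≡ ⟦ x ⊗ y ⟧
    eval-⊗ (leaf i)     (leaf j)     = refl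
    eval-⊗ (leaf i)     (node a b L) = trans (comm _ _) (sym (foldl-snoc _ L (single i)))
    eval-⊗ (node a b L) (leaf j)     = sym (foldl-snoc _ L (single j))
    eval-⊗ (node a b L) (node c d M) = begin
      foldl _∙_ (ρ a ∙ ρ b) (map ⟦_⟧ᵇ L) ∙ foldl _∙_ (ρ c ∙ ρ d) (map ⟦_⟧ᵇ M)
        ≡⟨ ∙-foldl-absorb _ (ρ c) (ρ d) (map ⟦_⟧ᵇ M) ⟩
      foldl _∙_ (foldl _∙_ (ρ a ∙ ρ b) (map ⟦_⟧ᵇ L) ∙ (ρ c ∙ ρ d)) (map ⟦_⟧ᵇ M)
        ≡⟨ foldl-++ _∙_ _ (map ⟦_⟧ᵇ L) _ ⟨
      foldl _∙_ (ρ a ∙ ρ b) (map ⟦_⟧ᵇ L ++ map ⟦_⟧ᵇ (pair c d ∷ M))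
        ≡⟨ cong (foldl _∙_ (ρ a ∙ ρ b)) (map-++ ⟦_⟧ᵇ L (pair c d ∷ M)) ⟨
      foldl _∙_ (ρ a ∙ ρ b) (map ⟦_⟧ᵇ (L ++ pair c d ∷ M))
        ∎
      where open ≡-Reasoning

    eval-flatten : ∀ t → eval _∙_ ρ t ≡ ⟦ flatten t ⟧
    eval-flatten (var i) = refl
    eval-flatten (s · t) = trans (cong₂ _∙_ (eval-flatten s) (eval-flatten t)) (eval-⊗ (flatten s) (flatten t))

    evalBlock-orient : ∀ x → ⟦ orient x ⟧ᵇ ≡ ⟦ x ⟧ᵇ
    evalBlock-orient (single i) = refl
    evalBlock-orient (pair i j) with i ≤? j
    ... | yes _ = refl
    ... | no  _ = comm _ _

    evalFlat-sameBlocks : ∀ {a b c d L M} → SameBlocks (pair a b ∷ L) (pair c d ∷ M) →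
                          ⟦ node a b L ⟧ ≡ ⟦ node c d M ⟧
    evalFlat-sameBlocks {a} {b} {c} {d} {L} {M} same =
      foldl-∙-↭ (ρ a) (ρ b) (ρ c) (ρ d) (↭-trans (↭-reflexive (values (pair a b ∷ L)))
        (↭-trans (map⁺ ⟦_⟧ᵇ same) (↭-reflexive (sym (values (pair c d ∷ M))))))
      where
      values : ∀ X → map ⟦_⟧ᵇ X ≡ map ⟦_⟧ᵇ (map orient X)
      values X = trans (map-cong (λ x → sym (evalBlock-orient x)) X) (map-∘ X)

  sameOp-flatten : ∀ {n} {s t : Term n} {a b c d L M} →
                   flatten s ≡ node a b L → flatten t ≡ node c d M →
                   SameBlocks (pair a b ∷ L) (pair c d ∷ M) → SameOp _∙_ s t
  sameOp-flatten {s = s} {t} {a} {b} {c} {d} {L} {M} fs ft same ρ = begin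
    eval _∙_ ρ s                 ≡⟨ eval-flatten ρ s ⟩
    evalFlat _∙_ ρ (flatten s)   ≡⟨ cong (evalFlat _∙_ ρ) fs ⟩
    evalFlat _∙_ ρ (node a b L)  ≡⟨ evalFlat-sameBlocks ρ same ⟩
    evalFlat _∙_ ρ (node c d M)  ≡⟨ cong (evalFlat _∙_ ρ) ft ⟨
    evalFlat _∙_ ρ (flatten t)   ≡⟨ eval-flatten ρ t ⟨
    eval _∙_ ρ t                 ∎
    where open ≡-Reasoning

-- A partition of {0, …, n-1} into blocks of size at most 2, described from its least
-- element 0: either 0 is a singleton, or it is paired with one of w n admissible
-- partners; the remaining elements are then renumbered in increasing order.
data Pairing (w : ℕ → ℕ) : ℕ → Set where
  []      : Pairing w 0
  single∷ : ∀ {n} → Pairing w n → Pairing w (suc n)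
  pair∷   : ∀ {n} → Fin (w n) → Pairing w n → Pairing w (suc (suc n))

single∷-injective : ∀ {w n} {p p′ : Pairing w n} → single∷ p ≡ single∷ p′ → p ≡ p′
single∷-injective refl = refl

pair∷-injective : ∀ {w n} {j j′ : Fin (w n)} {p p′ : Pairing w n} →
                  pair∷ j p ≡ pair∷ j′ p′ → j ≡ j′ × p ≡ p′
pair∷-injective refl = refl , refl

singles : ∀ {w} n → Pairing w n
singles zero    = []
singles (suc n) = single∷ (singles n)

pairings : (ℕ → ℕ) → ℕ → ℕ
pairings w zero          = 1
pairings w (suc zero)    = 1
pairings w (suc (suc n)) = pairings w (suc n) + w n * pairings w n

Pairing-uncons : ∀ {w n} → Pairing w (suc (suc n)) ↔ (Pairing w (suc n) ⊎ (Fin (w n) × Pairing w n))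
Pairing-uncons {w} {n} = mk↔ₛ′ uncons cons uncons∘cons cons∘uncons
  where
  uncons : Pairing w (suc (suc n)) → Pairing w (suc n) ⊎ (Fin (w n) × Pairing w n)
  uncons (single∷ p) = inj₁ p
  uncons (pair∷ j p) = inj₂ (j , p)

  cons : Pairing w (suc n) ⊎ (Fin (w n) × Pairing w n) → Pairing w (suc (suc n))
  cons (inj₁ p)       = single∷ p
  cons (inj₂ (j , p)) = pair∷ j p

  uncons∘cons : ∀ s → uncons (cons s) ≡ s
  uncons∘cons (inj₁ _) = refl
  uncons∘cons (inj₂ _) = refl

  cons∘uncons : ∀ p → cons (uncons p) ≡ p
  cons∘uncons (single∷ _) = refl
  cons∘uncons (pair∷ _ _) = refl

Pairing↔Fin : ∀ w n → Pairing w n ↔ Fin (pairings w n)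
Pairing↔Fin w zero =
  mk↔ₛ′ (λ _ → zero) (λ _ → []) (λ { zero → refl }) (λ { [] → refl })
Pairing↔Fin w (suc zero) =
  mk↔ₛ′ (λ _ → zero) (λ _ → single∷ []) (λ { zero → refl }) (λ { (single∷ []) → refl })
Pairing↔Fin w (suc (suc n)) =
  ↔-trans Pairing-uncons
    (↔-trans (Pairing↔Fin w (suc n) ⊎-↔ (↔-refl ×-↔ Pairing↔Fin w n))
      (↔-trans (↔-refl ⊎-↔ ↔-sym *↔×) (↔-sym +↔⊎)))

suc-pred-pairings : ∀ w n → suc (pairings w n ∸ 1) ≡ pairings w n
suc-pred-pairings w zero          = refl
suc-pred-pairings w (suc zero)    = refl
suc-pred-pairings w (suc (suc n)) rewrite sym (suc-pred-pairings w (suc n)) = refl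

module Enumeration (w : ℕ → ℕ) (n : ℕ) where

  private
    index : Pairing w n ↔ Fin (suc (pairings w n ∸ 1))
    index = subst (λ k → Pairing w n ↔ Fin k) (sym (suc-pred-pairings w n)) (Pairing↔Fin w n)

    open Inverse index using (to; from; strictlyInverseˡ; strictlyInverseʳ)

  -- Only the three properties below are needed; keeping nontrivial opaque stops the type
  -- checker from unfolding it into the arithmetic of the bijection.
  opaque
    private
      trivial : Fin (suc (pairings w n ∸ 1))
      trivial = to (singles n)

    nontrivial : Fin (pairings w n ∸ 1) → Pairing w n
    nontrivial i = from (punchIn trivial i)

    nontrivial-injective : ∀ i j → nontrivial i ≡ nontrivial j → i ≡ j
    nontrivial-injective i j eq = punchIn-injective trivial i j (begin
      punchIn trivial i  ≡⟨ strictlyInverseˡ _ ⟨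
      to (nontrivial i)  ≡⟨ cong to eq ⟩
      to (nontrivial j)  ≡⟨ strictlyInverseˡ _ ⟩
      punchIn trivial j  ∎)
      where open ≡-Reasoning

    nontrivial≢singles : ∀ i → nontrivial i ≢ singles n
    nontrivial≢singles i eq = punchInᵢ≢i trivial i (trans (sym (strictlyInverseˡ _)) (cong to eq))

    nontrivial-surjective : ∀ p → p ≢ singles n → ∃ λ i → nontrivial i ≡ p
    nontrivial-surjective p p≢singles =
      punchOut trivial≢p , trans (cong from (punchIn-punchOut trivial≢p)) (strictlyInverseʳ p)
      where
      trivial≢p : trivial ≢ to p
      trivial≢p eq = p≢singles (trans (sym (strictlyInverseʳ p)) (trans (cong from (sym eq)) (strictlyInverseʳ _)))

-- In a matching the partner of 0 is any of the elements 1, …, n-1 (the index j stands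
-- for j + 1); in a path matching it can only be 1.
Matching : ℕ → Set
Matching = Pairing suc

PathMatching : ℕ → Set
PathMatching = Pairing (λ _ → 1)

B2≡pairings : ∀ n → B2 n ≡ pairings suc n
B2≡pairings zero          = refl
B2≡pairings (suc zero)    = refl
B2≡pairings (suc (suc n)) = cong₂ (λ x y → x + suc n * y) (B2≡pairings (suc n)) (B2≡pairings n)

fib≡pairings : ∀ n → fib (suc n) ≡ pairings (λ _ → 1) n
fib≡pairings zero          = refl
fib≡pairings (suc zero)    = refl
fib≡pairings (suc (suc n)) =
  cong₂ _+_ (fib≡pairings (suc n)) (trans (fib≡pairings n) (sym (*-identityˡ _)))

embed : ∀ {n} → PathMatching n → Matching n
embed []          = []
embed (single∷ q) = single∷ (embed q)
embed (pair∷ _ q) = pair∷ zero (embed q)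

embed-injective : ∀ {n} {q q′ : PathMatching n} → embed q ≡ embed q′ → q ≡ q′
embed-injective {q = []}          {[]}           _  = refl
embed-injective {q = single∷ q}   {single∷ q′}   eq = cong single∷ (embed-injective (single∷-injective eq))
embed-injective {q = pair∷ zero q} {pair∷ zero q′} eq =
  cong (pair∷ zero) (embed-injective (proj₂ (pair∷-injective eq)))
embed-injective {q = single∷ _}   {pair∷ _ _}    ()
embed-injective {q = pair∷ _ _}   {single∷ _}    ()

embed-singles : ∀ n → embed (singles n) ≡ singles n
embed-singles zero    = refl
embed-singles (suc n) = cong single∷ (embed-singles n)

blocks : ∀ {n} → Matching n → List (Block n)
blocks []          = []
blocks (single∷ m) = single zero ∷ map (relabel suc) (blocks m)
blocks (pair∷ j m) = pair zero (suc j) ∷ map (relabel (suc ∘ punchIn j)) (blocks m)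

vars-relabel : ∀ {n m} (f : Fin n → Fin m) L → vars (map (relabel f) L) ≡ map f (vars L)
vars-relabel f []      = refl
vars-relabel f (x ∷ L) =
  trans (cong₂ _++_ (blockVars-relabel x) (vars-relabel f L)) (sym (map-++ f (blockVars x) (vars L)))
  where
  blockVars-relabel : ∀ x → blockVars (relabel f x) ≡ map f (blockVars x)
  blockVars-relabel (single _) = refl
  blockVars-relabel (pair _ _) = refl

allFin-suc : ∀ n → allFin (suc n) ≡ zero ∷ map suc (allFin n)
allFin-suc n = cong (zero ∷_) (sym (map-tabulate id suc))

allFin-punchIn : ∀ {n} (j : Fin (suc n)) → allFin (suc n) ↭ j ∷ map (punchIn j) (allFin n)
allFin-punchIn {n}     zero    = ↭-reflexive (allFin-suc n)
allFin-punchIn {suc n} (suc j) = begin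
  allFin (suc (suc n))                                  ≡⟨ allFin-suc (suc n) ⟩
  zero ∷ map suc (allFin (suc n))                       ↭⟨ prep zero (map⁺ suc (allFin-punchIn j)) ⟩
  zero ∷ suc j ∷ map suc (map (punchIn j) (allFin n))   ↭⟨ swap zero (suc j) ↭-refl ⟩
  suc j ∷ zero ∷ map suc (map (punchIn j) (allFin n))   ≡⟨ cong (suc j ∷_) shift-punchIn ⟨
  suc j ∷ map (punchIn (suc j)) (allFin (suc n))        ∎
  where
  open PermutationReasoning
  shift-punchIn : map (punchIn (suc j)) (allFin (suc n)) ≡ zero ∷ map suc (map (punchIn j) (allFin n))
  shift-punchIn = trans (cong (map (punchIn (suc j))) (allFin-suc n))
                        (cong (zero ∷_) (trans (sym (map-∘ (allFin n))) (map-∘ (allFin n))))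

allFin-pair : ∀ {n} (j : Fin (suc n)) →
              zero ∷ suc j ∷ map (suc ∘ punchIn j) (allFin n) ↭ allFin (suc (suc n))
allFin-pair {n} j = begin
  zero ∷ suc j ∷ map (suc ∘ punchIn j) (allFin n)  ≡⟨ cong (λ xs → zero ∷ suc j ∷ xs) (map-∘ (allFin n)) ⟩
  zero ∷ map suc (j ∷ map (punchIn j) (allFin n))  ↭⟨ prep zero (map⁺ suc (↭-sym (allFin-punchIn j))) ⟩
  zero ∷ map suc (allFin (suc n))                  ≡⟨ allFin-suc (suc n) ⟨
  allFin (suc (suc n))                             ∎
  where open PermutationReasoning

vars-blocks : ∀ {n} (m : Matching n) → vars (blocks m) ↭ allFin n
vars-blocks []              = ↭-refl
vars-blocks (single∷ {n} m) = begin
  zero ∷ vars (map (relabel suc) (blocks m))  ≡⟨ cong (zero ∷_) (vars-relabel suc (blocks m)) ⟩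
  zero ∷ map suc (vars (blocks m))            ↭⟨ prep zero (map⁺ suc (vars-blocks m)) ⟩
  zero ∷ map suc (allFin n)                   ≡⟨ allFin-suc n ⟨
  allFin (suc n)                              ∎
  where open PermutationReasoning
vars-blocks (pair∷ {n} j m) = begin
  zero ∷ suc j ∷ vars (map (relabel (suc ∘ punchIn j)) (blocks m))
    ≡⟨ cong (λ xs → zero ∷ suc j ∷ xs) (vars-relabel (suc ∘ punchIn j) (blocks m)) ⟩
  zero ∷ suc j ∷ map (suc ∘ punchIn j) (vars (blocks m))
    ↭⟨ prep zero (prep (suc j) (map⁺ (suc ∘ punchIn j) (vars-blocks m))) ⟩
  zero ∷ suc j ∷ map (suc ∘ punchIn j) (allFin n)
    ↭⟨ allFin-pair j ⟩
  allFin (suc (suc n))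
    ∎
  where open PermutationReasoning

vars-blocks-embed : ∀ {n} (q : PathMatching n) → vars (blocks (embed q)) ≡ allFin n
vars-blocks-embed []              = refl
vars-blocks-embed (single∷ {n} q) =
  trans (cong (zero ∷_) (trans (vars-relabel suc (blocks (embed q))) (cong (map suc) (vars-blocks-embed q))))
        (sym (allFin-suc n))
vars-blocks-embed (pair∷ {n} _ q) =
  trans (cong (λ xs → zero ∷ suc zero ∷ xs)
              (trans (vars-relabel up₂ (blocks (embed q))) (cong (map up₂) (vars-blocks-embed q))))
        (cong (λ xs → zero ∷ suc zero ∷ xs) (map-tabulate id up₂))
  where
  up₂ : Fin n → Fin (suc (suc n))
  up₂ i = suc (punchIn zero i)

infixl 5 _·ᵇ_
_·ᵇ_ : ∀ {n} → Term n → Block n → Term n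
t ·ᵇ single i = t · var i
t ·ᵇ pair i j = t · (var i · var j)

termOf : ∀ {n} → Block n → List (Block n) → Term n
termOf (single i) []      = var i
termOf (single i) (y ∷ L) = var i · termOf y L
termOf (pair i j) L       = foldl _·ᵇ_ (var i · var j) L

leaves-foldl : ∀ {n} (t : Term n) L → leaves (foldl _·ᵇ_ t L) ≡ leaves t ++ vars L
leaves-foldl t []      = sym (++-identityʳ (leaves t))
leaves-foldl t (x ∷ L) =
  trans (leaves-foldl (t ·ᵇ x) L)
        (trans (cong (_++ vars L) (leaves-·ᵇ x)) (++-assoc (leaves t) (blockVars x) (vars L)))
  where
  leaves-·ᵇ : ∀ x → leaves (t ·ᵇ x) ≡ leaves t ++ blockVars x
  leaves-·ᵇ (single _) = refl
  leaves-·ᵇ (pair _ _) = refl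

leaves-termOf : ∀ {n} (x : Block n) L → leaves (termOf x L) ≡ vars (x ∷ L)
leaves-termOf (single i) []      = refl
leaves-termOf (single i) (y ∷ L) = cong (i ∷_) (leaves-termOf y L)
leaves-termOf (pair i j) L       = leaves-foldl (var i · var j) L

flatten-·ᵇ : ∀ {n} {t : Term n} {a b M} x → flatten t ≡ node a b M →
             flatten (t ·ᵇ x) ≡ node a b (M ++ [ x ])
flatten-·ᵇ (single _) eq rewrite eq = refl
flatten-·ᵇ (pair _ _) eq rewrite eq = refl

flatten-foldl : ∀ {n} {t : Term n} {a b M} L → flatten t ≡ node a b M →
                flatten (foldl _·ᵇ_ t L) ≡ node a b (M ++ L)
flatten-foldl {M = M} []      eq = trans eq (cong (node _ _) (sym (++-identityʳ M)))
flatten-foldl {a = a} {b} {M} (x ∷ L) eq =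
  trans (flatten-foldl L (flatten-·ᵇ x eq)) (cong (node a b) (++-assoc M [ x ] L))

FlattensTo : ∀ {n} → Term n → List (Block n) → Set
FlattensTo {n} t L =
  Σ (Fin n) λ a → Σ (Fin n) λ b → Σ (List (Block n)) λ M → flatten t ≡ node a b M × pair a b ∷ M ↭ L

flatten-termOf : ∀ {n} (x : Block n) L → Any IsPair (x ∷ L) → FlattensTo (termOf x L) (x ∷ L)
flatten-termOf (pair i j) L       _         = i , j , L , flatten-foldl L refl , ↭-refl
flatten-termOf (single i) []      (there ())
flatten-termOf (single i) (y ∷ L) (there h) with flatten-termOf y L h
... | a , b , M , eq , perm =
  a , b , M ++ [ single i ] , cong (leaf i ⊗_) eq ,
  ↭-trans (++-comm (pair a b ∷ M) [ single i ]) (prep (single i) perm)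

canon : ∀ {n} → Matching (suc n) → Term (suc n)
canon (single∷ m) = termOf (single zero) (map (relabel suc) (blocks m))
canon (pair∷ j m) = termOf (pair zero (suc j)) (map (relabel (suc ∘ punchIn j)) (blocks m))

leaves-canon : ∀ {n} (m : Matching (suc n)) → leaves (canon m) ≡ vars (blocks m)
leaves-canon (single∷ m) = leaves-termOf (single zero) (map (relabel suc) (blocks m))
leaves-canon (pair∷ j m) = leaves-termOf (pair zero (suc j)) (map (relabel (suc ∘ punchIn j)) (blocks m))

flatten-canon : ∀ {n} (m : Matching (suc n)) → Any IsPair (blocks m) → FlattensTo (canon m) (blocks m)
flatten-canon (single∷ m) = flatten-termOf (single zero) (map (relabel suc) (blocks m))
flatten-canon (pair∷ j m) = flatten-termOf (pair zero (suc j)) (map (relabel (suc ∘ punchIn j)) (blocks m))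

canon-fullLinear : ∀ {n} (m : Matching (suc n)) → IsFullLinear (canon m)
canon-fullLinear m = ↭-trans (↭-reflexive (leaves-canon m)) (vars-blocks m)

canon-bracketing : ∀ {n} (q : PathMatching (suc n)) → IsBracketing (canon (embed q))
canon-bracketing q = trans (leaves-canon (embed q)) (vars-blocks-embed q)

IsPair-relabel : ∀ {k n} (g : Fin k → Fin n) {x} → IsPair x → IsPair (relabel g x)
IsPair-relabel g {pair _ _} _ = tt

IsPair-relabel⁻ : ∀ {k n} (g : Fin k → Fin n) {x} → IsPair (relabel g x) → IsPair x
IsPair-relabel⁻ g {pair _ _}  _ = tt
IsPair-relabel⁻ g {single _} ()

IsPair-orient : ∀ {n} {x : Block n} → IsPair x → IsPair (orient x)
IsPair-orient {x = pair i j} _ with i ≤? j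
... | yes _ = tt
... | no  _ = tt

IsPair-orient⁻ : ∀ {n} {x : Block n} → IsPair (orient x) → IsPair x
IsPair-orient⁻ {x = pair _ _}  _ = tt
IsPair-orient⁻ {x = single _} ()

SameBlocks-pair : ∀ {n} {L M : List (Block n)} → SameBlocks L M → Any IsPair L → Any IsPair M
SameBlocks-pair same hasPair =
  Any.map IsPair-orient⁻ (Any.map⁻ {P = IsPair} (Any-resp-↭ same (Any.map⁺ (Any.map IsPair-orient hasPair))))

pair⇒nontrivial : ∀ {n} (m : Matching n) → Any IsPair (blocks m) → m ≢ singles n
pair⇒nontrivial m hasPair refl = singles-unpaired _ hasPair
  where
  singles-unpaired : ∀ n → ¬ Any IsPair (blocks (singles {suc} n))
  singles-unpaired (suc n) (there h) = singles-unpaired n (Any.map (IsPair-relabel⁻ suc) (Any.map⁻ h))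

nontrivial⇒pair : ∀ {n} (m : Matching n) → m ≢ singles n → Any IsPair (blocks m)
nontrivial⇒pair []          m≢singles = ⊥-elim (m≢singles refl)
nontrivial⇒pair (single∷ m) m≢singles =
  there (Any.map⁺ (Any.map (IsPair-relabel suc) (nontrivial⇒pair m (m≢singles ∘ cong single∷))))
nontrivial⇒pair (pair∷ _ _) _         = here tt

orient-comm : ∀ {n} (i j : Fin n) → orient (pair i j) ≡ orient (pair j i)
orient-comm i j with i ≤? j | j ≤? i
... | yes i≤j | yes j≤i rewrite ≤-antisym i≤j j≤i = refl
... | yes _   | no  _   = refl
... | no  _   | yes _   = refl
... | no  i≰j | no  j≰i = ⊥-elim ([ i≰j , j≰i ]′ (≤-total i j))

SameBlocks-cons : ∀ {n} {L R M : List (Block n)} {x y} → L ↭ x ∷ R → orient x ≡ orient y →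
                  SameBlocks R M → SameBlocks L (y ∷ M)
SameBlocks-cons L↭ x≈y same =
  ↭-trans (map⁺ orient L↭) (↭-trans (↭-reflexive (cong (_∷ _) x≈y)) (prep _ same))

vars-↭ : ∀ {n} {L M : List (Block n)} → L ↭ M → vars L ↭ vars M
vars-↭ ↭.refl                     = ↭-refl
vars-↭ (prep x p)                 = ++⁺ˡ (blockVars x) (vars-↭ p)
vars-↭ (swap {xs = L} {M} x y p) = begin
  blockVars x ++ blockVars y ++ vars L    ≡⟨ ++-assoc (blockVars x) (blockVars y) (vars L) ⟨
  (blockVars x ++ blockVars y) ++ vars L  ↭⟨ ++⁺ʳ (vars L) (++-comm (blockVars x) (blockVars y)) ⟩
  (blockVars y ++ blockVars x) ++ vars L  ≡⟨ ++-assoc (blockVars y) (blockVars x) (vars L) ⟩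
  blockVars y ++ blockVars x ++ vars L    ↭⟨ ++⁺ˡ (blockVars y) (++⁺ˡ (blockVars x) (vars-↭ p)) ⟩
  blockVars y ++ blockVars x ++ vars M    ∎
  where open PermutationReasoning
vars-↭ (↭.trans p q)              = ↭-trans (vars-↭ p) (vars-↭ q)

vars-empty : ∀ {n} (L : List (Block n)) → vars L ↭ [] → L ≡ []
vars-empty []               _ = refl
vars-empty (single _ ∷ _)   p with ↭-empty-inv p
... | ()
vars-empty (pair _ _ ∷ _)   p with ↭-empty-inv p
... | ()

blockOf : ∀ {n} {v : Fin n} L → v ∈ vars L →
          Σ (Block n) λ x → Σ (List (Block n)) λ R → L ↭ x ∷ R × v ∈ blockVars x
blockOf (x ∷ L) v∈ with ∈-++⁻ (blockVars x) v∈
... | inj₁ v∈x = x , L , ↭-refl , v∈x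
... | inj₂ v∈L with blockOf L v∈L
...   | y , R , L↭ , v∈y = y , x ∷ R , ↭-trans (prep x L↭) (swap x y ↭-refl) , v∈y

data SplitAt₀ : ∀ k {n} → (Fin (suc k) → Fin n) → List (Block n) → Set where
  alone  : ∀ {k n} {g : Fin (suc k) → Fin n} {L R} →
           L ↭ single (g zero) ∷ R → vars R ↭ map (g ∘ suc) (allFin k) → SplitAt₀ k g L
  paired : ∀ {k n} {g : Fin (suc (suc k)) → Fin n} {L x R} (j : Fin (suc k)) →
           L ↭ x ∷ R → orient x ≡ orient (pair (g zero) (g (suc j))) →
           vars R ↭ map (g ∘ suc ∘ punchIn j) (allFin k) → SplitAt₀ (suc k) g L

splitPaired : ∀ {k n} (g : Fin (suc k) → Fin n) {L x R} (j : Fin k) → L ↭ x ∷ R →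
              orient x ≡ orient (pair (g zero) (g (suc j))) →
              g (suc j) ∷ vars R ↭ map (g ∘ suc) (allFin k) → SplitAt₀ k g L
splitPaired {suc k} g j L↭ x≈ q =
  paired j L↭ x≈ (drop-∷ (↭-trans q (↭-trans (map⁺ (g ∘ suc) (allFin-punchIn j))
                                              (↭-reflexive (cong (g (suc j) ∷_) (sym (map-∘ (allFin k))))))))

splitAt₀ : ∀ {k n} (g : Fin (suc k) → Fin n) L → vars L ↭ map g (allFin (suc k)) → SplitAt₀ k g L
splitAt₀ {k} g L p with blockOf L (∈-resp-↭ (↭-sym p) (here refl))
... | x , R , L↭ , g₀∈x =
  classify x g₀∈x (↭-trans (vars-↭ (↭-sym L↭)) (↭-trans p (↭-reflexive map-allFin))) L↭
  where
  map-allFin : map g (allFin (suc k)) ≡ g zero ∷ map (g ∘ suc) (allFin k)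
  map-allFin = cong (g zero ∷_) (trans (map-tabulate suc g) (sym (map-tabulate id (g ∘ suc))))

  classify : ∀ x → g zero ∈ blockVars x → blockVars x ++ vars R ↭ g zero ∷ map (g ∘ suc) (allFin k) →
             L ↭ x ∷ R → SplitAt₀ k g L
  classify (single _) (here refl) q L↭ = alone L↭ (drop-∷ q)
  classify (pair _ c) (here refl) q L↭ with ∈-map⁻ (g ∘ suc) (∈-resp-↭ (drop-∷ q) (here refl))
  ... | j , _ , refl = splitPaired g j L↭ refl (drop-∷ q)
  classify (pair c _) (there (here refl)) q L↭
    with ∈-map⁻ (g ∘ suc) (∈-resp-↭ (drop-∷ (↭-trans (swap (g zero) c ↭-refl) q)) (here refl))
  ... | j , _ , refl = splitPaired g j L↭ (orient-comm _ _) (drop-∷ (↭-trans (swap (g zero) _ ↭-refl) q))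

map-relabel-∘ : ∀ {k m n} (g : Fin m → Fin n) (f : Fin k → Fin m) X →
                map (relabel (g ∘ f)) X ≡ map (relabel g) (map (relabel f) X)
map-relabel-∘ g f X = trans (map-cong relabel-∘ X) (map-∘ X)
  where
  relabel-∘ : ∀ x → relabel (g ∘ f) x ≡ relabel g (relabel f x)
  relabel-∘ (single _) = refl
  relabel-∘ (pair _ _) = refl

-- Stated for the image of an arbitrary g rather than for allFin k, so that the blocks left
-- after removing the block of g 0 never have to be renumbered.
matchingOf : ∀ {n} k (g : Fin k → Fin n) L → vars L ↭ map g (allFin k) →
             Σ (Matching k) λ m → SameBlocks L (map (relabel g) (blocks m))
matchingOf zero g L p rewrite vars-empty L p = [] , ↭-refl
matchingOf (suc k) g L p with splitAt₀ g L p
... | alone {R = R} L↭ vR with matchingOf k (g ∘ suc) R vR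
...   | m , same = single∷ m ,
        SameBlocks-cons {y = single (g zero)} L↭ refl (subst (SameBlocks R) (map-relabel-∘ g suc (blocks m)) same)
matchingOf (suc (suc k)) g L p | paired {R = R} j L↭ x≈ vR with matchingOf k (g ∘ suc ∘ punchIn j) R vR
...   | m , same = pair∷ j m ,
        SameBlocks-cons L↭ x≈ (subst (SameBlocks R) (map-relabel-∘ g (suc ∘ punchIn j) (blocks m)) same)

map-relabel-id : ∀ {n} (X : List (Block n)) → map (relabel id) X ≡ X
map-relabel-id X = trans (map-cong relabel-id X) (map-id X)
  where
  relabel-id : ∀ x → relabel id x ≡ x
  relabel-id (single _) = refl
  relabel-id (pair _ _) = refl

matchingOfPartition : ∀ {n} (L : List (Block n)) → vars L ↭ allFin n →
                      Σ (Matching n) λ m → SameBlocks L (blocks m)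
matchingOfPartition {n} L p =
  let m , same = matchingOf n id L (↭-trans p (↭-reflexive (sym (map-id (allFin n)))))
  in m , subst (SameBlocks L) (map-relabel-id (blocks m)) same

vars-++ : ∀ {n} (A B : List (Block n)) → vars (A ++ B) ≡ vars A ++ vars B
vars-++ []      B = refl
vars-++ (x ∷ A) B = trans (cong (blockVars x ++_) (vars-++ A B)) (sym (++-assoc (blockVars x) (vars A) (vars B)))

vars-blocksOf-⊗ : ∀ {n} (x y : Flat n) → vars (blocksOf (x ⊗ y)) ↭ vars (blocksOf x) ++ vars (blocksOf y)
vars-blocksOf-⊗ (leaf i)     (leaf j)     = ↭-refl
vars-blocksOf-⊗ (leaf i)     (node a b L) =
  ↭-trans (↭-reflexive (cong (λ xs → a ∷ b ∷ xs) (vars-++ L [ single i ]))) (++-comm (a ∷ b ∷ vars L) [ i ])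
vars-blocksOf-⊗ (node a b L) (leaf j)     = ↭-reflexive (cong (λ xs → a ∷ b ∷ xs) (vars-++ L [ single j ]))
vars-blocksOf-⊗ (node a b L) (node c d M) = ↭-reflexive (cong (λ xs → a ∷ b ∷ xs) (vars-++ L (pair c d ∷ M)))

vars-blocksOf-flatten : ∀ {n} (t : Term n) → vars (blocksOf (flatten t)) ↭ leaves t
vars-blocksOf-flatten (var i) = ↭-refl
vars-blocksOf-flatten (s · t) =
  ↭-trans (vars-blocksOf-⊗ (flatten s) (flatten t)) (++⁺ (vars-blocksOf-flatten s) (vars-blocksOf-flatten t))

flatten-fullLinear : ∀ {n} (t : Term (suc (suc n))) → IsFullLinear t →
                     Σ (Fin (suc (suc n))) λ a → Σ (Fin (suc (suc n))) λ b → Σ (List (Block (suc (suc n)))) λ M →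
                     flatten t ≡ node a b M
flatten-fullLinear (var i) fl with ↭-length fl
... | ()
flatten-fullLinear (s · t) _ = node-⊗ (flatten s) (flatten t)
  where
  node-⊗ : ∀ x y → Σ _ λ a → Σ _ λ b → Σ _ λ M → x ⊗ y ≡ node a b M
  node-⊗ (leaf i)     (leaf j)     = _ , _ , _ , refl
  node-⊗ (leaf i)     (node a b L) = _ , _ , _ , refl
  node-⊗ (node a b L) (leaf j)     = _ , _ , _ , refl
  node-⊗ (node a b L) (node c d M) = _ , _ , _ , refl

Adjacent : ∀ {n} → Block n → Set
Adjacent (single _) = ⊤
Adjacent (pair i j) = toℕ j ≡ suc (toℕ i) ⊎ toℕ i ≡ suc (toℕ j)

Adjacent-orient : ∀ {n} {x : Block n} → Adjacent x → Adjacent (orient x)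
Adjacent-orient {x = single _} adj = adj
Adjacent-orient {x = pair i j} adj with i ≤? j
... | yes _ = adj
... | no  _ = Sum.swap adj

Adjacent-orient⁻ : ∀ {n} {x : Block n} → Adjacent (orient x) → Adjacent x
Adjacent-orient⁻ {x = single _} adj = adj
Adjacent-orient⁻ {x = pair i j} adj with i ≤? j
... | yes _ = adj
... | no  _ = Sum.swap adj

SameBlocks-adjacent : ∀ {n} {L M : List (Block n)} → SameBlocks L M → All Adjacent L → All Adjacent M
SameBlocks-adjacent same adj =
  All.map Adjacent-orient⁻ (All.map⁻ {P = Adjacent} (All-resp-↭ same (All.map⁺ (All.map Adjacent-orient adj))))

Adjacent-shift⁻ : ∀ {k n} (g : Fin k → Fin n) c → (∀ i → toℕ (g i) ≡ c + toℕ i) →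
                  ∀ {x} → Adjacent (relabel g x) → Adjacent x
Adjacent-shift⁻ g c shift {single _} _ = tt
Adjacent-shift⁻ g c shift {pair i j} adj = Sum.map (cancel i j) (cancel j i) adj
  where
  cancel : ∀ a b → toℕ (g b) ≡ suc (toℕ (g a)) → toℕ b ≡ suc (toℕ a)
  cancel a b eq = +-cancelˡ-≡ c _ _ (trans (sym (shift b)) (trans eq (trans (cong suc (shift a)) (sym (+-suc c _)))))

pathMatchingOf : ∀ {n} (m : Matching n) → All Adjacent (blocks m) → Σ (PathMatching n) λ q → embed q ≡ m
pathMatchingOf []                []          = [] , refl
pathMatchingOf (single∷ m)       (_ ∷ adj)
  with pathMatchingOf m (All.map (Adjacent-shift⁻ suc 1 (λ _ → refl)) (All.map⁻ adj))
... | q , refl = single∷ q , refl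
pathMatchingOf (pair∷ zero m)    (_ ∷ adj)
  with pathMatchingOf m (All.map (Adjacent-shift⁻ (λ i → suc (punchIn zero i)) 2 (λ _ → refl)) (All.map⁻ adj))
... | q , refl = pair∷ zero q , refl
pathMatchingOf (pair∷ (suc _) _) (inj₁ () ∷ _)
pathMatchingOf (pair∷ (suc _) _) (inj₂ () ∷ _)

Consecutive : ∀ {n} → List (Fin n) → Set
Consecutive = Linked (λ i j → toℕ j ≡ suc (toℕ i))

allFin-consecutive : ∀ n → Consecutive (allFin n)
allFin-consecutive zero          = []
allFin-consecutive (suc zero)    = [-]
allFin-consecutive (suc (suc n)) =
  subst Consecutive (sym (allFin-suc (suc n))) (refl ∷ Linked.map⁺ (Linked.map (cong suc) (allFin-consecutive (suc n))))

Consecutive-++⁻ : ∀ {n} (xs : List (Fin n)) {ys} → Consecutive (xs ++ ys) → Consecutive xs × Consecutive ys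
Consecutive-++⁻ []           c       = [] , c
Consecutive-++⁻ (x ∷ [])     c       = [-] , Linked.tail c
Consecutive-++⁻ (x ∷ y ∷ xs) (r ∷ c) with Consecutive-++⁻ (y ∷ xs) c
... | cxs , cys = r ∷ cxs , cys

flatten-leaf : ∀ {n} (t : Term n) {i} → flatten t ≡ leaf i → t ≡ var i
flatten-leaf (var _) refl = refl
flatten-leaf (s · t) eq   = ⊥-elim (⊗≢leaf (flatten s) (flatten t) eq)
  where
  ⊗≢leaf : ∀ x y {i} → x ⊗ y ≢ leaf i
  ⊗≢leaf (leaf _)     (leaf _)     ()
  ⊗≢leaf (leaf _)     (node _ _ _) ()
  ⊗≢leaf (node _ _ _) (leaf _)     ()
  ⊗≢leaf (node _ _ _) (node _ _ _) ()

blocks-adjacent : ∀ {n} (t : Term n) → Consecutive (leaves t) → All Adjacent (blocksOf (flatten t))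
blocks-adjacent (var _) _ = tt ∷ []
blocks-adjacent (s · u) c = combine (flatten s) (flatten u) refl refl
  where
  cs : Consecutive (leaves s)
  cs = proj₁ (Consecutive-++⁻ (leaves s) c)

  cu : Consecutive (leaves u)
  cu = proj₂ (Consecutive-++⁻ (leaves s) c)

  combine : ∀ x y → flatten s ≡ x → flatten u ≡ y → All Adjacent (blocksOf (x ⊗ y))
  combine (leaf i) (leaf j) fs fu
    with subst Consecutive (cong₂ _++_ (cong leaves (flatten-leaf s fs)) (cong leaves (flatten-leaf u fu))) c
  ... | j≡1+i ∷ _ = inj₁ j≡1+i ∷ []
  combine (leaf i) (node a b L) _ fu with subst (All Adjacent ∘ blocksOf) fu (blocks-adjacent u cu)
  ... | adj ∷ adjs = adj ∷ All.++⁺ adjs (tt ∷ [])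
  combine (node a b L) (leaf j) fs _ with subst (All Adjacent ∘ blocksOf) fs (blocks-adjacent s cs)
  ... | adj ∷ adjs = adj ∷ All.++⁺ adjs (tt ∷ [])
  combine (node a b L) (node c d M) fs fu with subst (All Adjacent ∘ blocksOf) fs (blocks-adjacent s cs)
  ... | adj ∷ adjs = adj ∷ All.++⁺ adjs (subst (All Adjacent ∘ blocksOf) fu (blocks-adjacent u cu))

record BlockDecomposition {n} (t : Term n) : Set where
  constructor decomposition
  field
    {first second} : Fin n
    {rest}         : List (Block n)
    matching       : Matching n
    flatten≡       : flatten t ≡ node first second rest
    sameBlocks     : SameBlocks (pair first second ∷ rest) (blocks matching)

  matching-nontrivial : matching ≢ singles n
  matching-nontrivial = pair⇒nontrivial matching (SameBlocks-pair sameBlocks (here tt))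

  matching-adjacent : IsBracketing t → All Adjacent (blocks matching)
  matching-adjacent br = SameBlocks-adjacent sameBlocks
    (subst (All Adjacent ∘ blocksOf) flatten≡ (blocks-adjacent t (subst Consecutive (sym br) (allFin-consecutive n))))

open BlockDecomposition using (matching; matching-nontrivial; matching-adjacent)

blockDecomposition : ∀ {n} (t : Term (suc (suc n))) → IsFullLinear t → BlockDecomposition t
blockDecomposition t fl with flatten-fullLinear t fl
... | a , b , M , flat≡ with matchingOfPartition (pair a b ∷ M)
       (↭-trans (subst (λ f → vars (blocksOf f) ↭ leaves t) flat≡ (vars-blocksOf-flatten t)) fl)
...   | m , same = decomposition m flat≡ same

module _ {G : Set} (_∙_ : G → G → G) {n : ℕ} (P : Term n → Set) where

  specLe-enumeration : ∀ {k} (enum : Fin k → Term n) → (∀ i → P (enum i)) →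
                       (∀ t → P t → ∃ λ i → SameOp _∙_ t (enum i)) → SpecLe _∙_ n P k
  specLe-enumeration enum P-enum covers =
    tabulate enum , VAll.tabulate⁺ P-enum , λ t Pt → Product.map₂ (λ {i} same ρ →
      trans (same ρ) (cong (eval _∙_ ρ) (sym (lookup∘tabulate enum i)))) (covers t Pt)

  specGe-enumeration : ∀ {k} (enum : Fin k → Term n) → (∀ i → P (enum i)) →
                       (∀ i j → i ≢ j → ¬ SameOp _∙_ (enum i) (enum j)) → SpecGe _∙_ n P k
  specGe-enumeration enum P-enum distinct =
    tabulate enum , VAll.tabulate⁺ P-enum , λ i j i≢j same → distinct i j i≢j λ ρ →
      trans (cong (eval _∙_ ρ) (sym (lookup∘tabulate enum i)))
            (trans (same ρ) (cong (eval _∙_ ρ) (lookup∘tabulate enum j)))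

fullLinearCanon : ∀ n → Fin (pairings suc (suc n) ∸ 1) → Term (suc n)
fullLinearCanon n = canon ∘ Enumeration.nontrivial suc (suc n)

bracketingCanon : ∀ n → Fin (pairings (λ _ → 1) (suc n) ∸ 1) → Term (suc n)
bracketingCanon n = canon ∘ embed ∘ Enumeration.nontrivial (λ _ → 1) (suc n)

module UpperBounds {G : Set} {_∙_ : G → G → G} (comm : Commutative _∙_) (ii : Ident-ii _∙_) where
  open Normalization comm ii

  sameOp-canon : ∀ {n} {t : Term (suc n)} (d : BlockDecomposition t) → SameOp _∙_ t (canon (matching d))
  sameOp-canon {t = t} (decomposition m flat≡ same) with flatten-canon m (SameBlocks-pair same (here tt))
  ... | _ , _ , _ , flat≡′ , perm =
    sameOp-flatten {s = t} {canon m} flat≡ flat≡′ (↭-trans same (map⁺ orient (↭-sym perm)))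

  fullLinear-covered : ∀ {n} (t : Term (suc (suc n))) → IsFullLinear t →
                       ∃ λ i → SameOp _∙_ t (fullLinearCanon (suc n) i)
  fullLinear-covered t fl with blockDecomposition t fl
  ... | d with Enumeration.nontrivial-surjective suc _ (matching d) (matching-nontrivial d)
  ...   | i , i↦m = i , subst (λ m → SameOp _∙_ t (canon m)) (sym i↦m) (sameOp-canon d)

  bracketing-covered : ∀ {n} (t : Term (suc (suc n))) → IsBracketing t →
                       ∃ λ i → SameOp _∙_ t (bracketingCanon (suc n) i)
  bracketing-covered t br with blockDecomposition t (↭-reflexive br)
  ... | d with pathMatchingOf (matching d) (matching-adjacent d br)
  ...   | q , q↦m with Enumeration.nontrivial-surjective (λ _ → 1) _ q
                         (λ { refl → matching-nontrivial d (trans (sym q↦m) (embed-singles _)) })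
  ...     | i , i↦q = i , subst (λ q → SameOp _∙_ t (canon (embed q))) (sym i↦q)
                            (subst (λ m → SameOp _∙_ t (canon m)) (sym q↦m) (sameOp-canon d))

  fullLinear-upper : ∀ n → SpecLe _∙_ (suc (suc n)) IsFullLinear (B2 (suc (suc n)) ∸ 1)
  fullLinear-upper n =
    subst (λ k → SpecLe _∙_ (suc (suc n)) IsFullLinear (k ∸ 1)) (sym (B2≡pairings (suc (suc n))))
      (specLe-enumeration _∙_ IsFullLinear (fullLinearCanon (suc n))
        (canon-fullLinear ∘ Enumeration.nontrivial suc _) fullLinear-covered)

  bracketing-upper : ∀ n → SpecLe _∙_ (suc (suc n)) IsBracketing (fib (suc (suc (suc n))) ∸ 1)
  bracketing-upper n =
    subst (λ k → SpecLe _∙_ (suc (suc n)) IsBracketing (k ∸ 1)) (sym (fib≡pairings (suc (suc n))))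
      (specLe-enumeration _∙_ IsBracketing (bracketingCanon (suc n))
        (canon-bracketing ∘ Enumeration.nontrivial (λ _ → 1) _) bracketing-covered)

PairIn : ∀ {n} → Fin n → Fin n → List (Block n) → Set
PairIn a b L = pair a b ∈ L ⊎ pair b a ∈ L

PairIn-resp-↭ : ∀ {n} {a b : Fin n} {L M} → L ↭ M → PairIn a b L → PairIn a b M
PairIn-resp-↭ L↭M = Sum.map (∈-resp-↭ L↭M) (∈-resp-↭ L↭M)

ExtraPair : ∀ {n} → List (Block n) → List (Block n) → Set
ExtraPair {n} L M = Σ (Fin n) λ a → Σ (Fin n) λ b → a ≢ b × pair a b ∈ L × ¬ PairIn a b M

pair-injective : ∀ {n} {a b c d : Fin n} → pair a b ≡ pair c d → a ≡ c × b ≡ d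
pair-injective refl = refl , refl

∈-relabel⁻ : ∀ {k n} {g : Fin k → Fin n} → (∀ {i j} → g i ≡ g j → i ≡ j) →
             ∀ {a b} X → pair (g a) (g b) ∈ map (relabel g) X → pair a b ∈ X
∈-relabel⁻ {g = g} g-inj X ab∈ with ∈-map⁻ (relabel g) ab∈
... | single _ , _   , ()
... | pair i j , ij∈ , eq with pair-injective eq
...   | ga≡gi , gb≡gj = subst₂ (λ u v → pair u v ∈ X) (sym (g-inj ga≡gi)) (sym (g-inj gb≡gj)) ij∈

∈-relabel-nonzero : ∀ {k n} {g : Fin k → Fin (suc n)} → (∀ i → g i ≢ zero) →
                    ∀ {u v} X → pair u v ∈ map (relabel g) X → u ≢ zero × v ≢ zero
∈-relabel-nonzero {g = g} g≢0 X uv∈ with ∈-map⁻ (relabel g) uv∈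
... | single _ , _ , ()
... | pair i j , _ , eq with pair-injective eq
...   | refl , refl = g≢0 i , g≢0 j

data StartsAtZero {n} : Block (suc n) → Set where
  single₀ : StartsAtZero (single zero)
  pair₀   : ∀ c → StartsAtZero (pair zero c)

StartsAtZero-pair : ∀ {n} {h : Block (suc n)} {u v} → StartsAtZero h → pair u v ≡ h → u ≡ zero
StartsAtZero-pair (pair₀ _) refl = refl

ExtraPair-relabel : ∀ {k n} (g : Fin k → Fin (suc n)) → (∀ {i j} → g i ≡ g j → i ≡ j) →
                    (∀ i → g i ≢ zero) →
                    ∀ {h h′} → StartsAtZero h′ → ∀ X X′ → ExtraPair X X′ →
                    ExtraPair (h ∷ map (relabel g) X) (h′ ∷ map (relabel g) X′)
ExtraPair-relabel g g-inj g≢0 h′₀ X X′ (a , b , a≢b , ab∈ , ab∉) =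
  g a , g b , a≢b ∘ g-inj , there (∈-map⁺ (relabel g) ab∈) , ab∉′
  where
  ab∉′ : ¬ PairIn (g a) (g b) (_ ∷ map (relabel g) X′)
  ab∉′ (inj₁ (here eq))  = g≢0 a (StartsAtZero-pair h′₀ eq)
  ab∉′ (inj₁ (there p))  = ab∉ (inj₁ (∈-relabel⁻ g-inj X′ p))
  ab∉′ (inj₂ (here eq))  = g≢0 b (StartsAtZero-pair h′₀ eq)
  ab∉′ (inj₂ (there p))  = ab∉ (inj₂ (∈-relabel⁻ g-inj X′ p))

ExtraPair-head : ∀ {k n} (g : Fin k → Fin (suc n)) → (∀ i → g i ≢ zero) → ∀ {c h′} → c ≢ zero →
                 pair zero c ≢ h′ → pair c zero ≢ h′ →
                 ∀ X Y → ExtraPair (pair zero c ∷ X) (h′ ∷ map (relabel g) Y)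
ExtraPair-head g g≢0 c≢0 ≢h′ ≢h′′ X Y = zero , _ , c≢0 ∘ sym , here refl , 0c∉
  where
  0c∉ : ¬ PairIn zero _ (_ ∷ map (relabel g) Y)
  0c∉ (inj₁ (here eq)) = ≢h′ eq
  0c∉ (inj₁ (there p)) = proj₁ (∈-relabel-nonzero g≢0 Y p) refl
  0c∉ (inj₂ (here eq)) = ≢h′′ eq
  0c∉ (inj₂ (there p)) = proj₂ (∈-relabel-nonzero g≢0 Y p) refl

extraPair : ∀ {n} (m m′ : Matching n) → m ≢ m′ →
            ExtraPair (blocks m) (blocks m′) ⊎ ExtraPair (blocks m′) (blocks m)
extraPair []          []            m≢m′ = ⊥-elim (m≢m′ refl)
extraPair (single∷ m) (single∷ m′)  m≢m′ = Sum.map lift lift (extraPair m m′ (m≢m′ ∘ cong single∷))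
  where
  lift : ∀ {X X′} → ExtraPair X X′ →
         ExtraPair (single zero ∷ map (relabel suc) X) (single zero ∷ map (relabel suc) X′)
  lift = ExtraPair-relabel suc suc-injective (λ _ ()) single₀ _ _
extraPair (single∷ m) (pair∷ j′ m′) _    = inj₂ (ExtraPair-head suc (λ _ ()) (λ ()) (λ ()) (λ ()) _ _)
extraPair (pair∷ j m) (single∷ m′)  _    = inj₁ (ExtraPair-head suc (λ _ ()) (λ ()) (λ ()) (λ ()) _ _)
extraPair (pair∷ j m) (pair∷ j′ m′) m≢m′ with j ≟ j′
... | yes refl = Sum.map lift lift (extraPair m m′ (m≢m′ ∘ cong (pair∷ j)))
  where
  lift : ∀ {X X′} → ExtraPair X X′ → ExtraPair (pair zero (suc j) ∷ map (relabel (suc ∘ punchIn j)) X)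
                                               (pair zero (suc j) ∷ map (relabel (suc ∘ punchIn j)) X′)
  lift = ExtraPair-relabel (suc ∘ punchIn j) (punchIn-injective j _ _ ∘ suc-injective) (λ _ ()) (pair₀ _) _ _
... | no j≢j′  = inj₁ (ExtraPair-head (suc ∘ punchIn j′) (λ _ ()) (λ ())
                         (j≢j′ ∘ suc-injective ∘ proj₂ ∘ pair-injective) (λ ()) _ _)

mark : ∀ {G : Set} {n} → Fin n → Fin n → G → G → Fin n → G
mark a b high low v with v ≟ a | v ≟ b
... | no _  | no _  = low
... | _     | _     = high

module _ {G : Set} {n} (a b : Fin n) (high low : G) where

  mark-first : mark a b high low a ≡ high
  mark-first with a ≟ a | a ≟ b
  ... | yes _   | _ = refl
  ... | no  a≢a | _ = ⊥-elim (a≢a refl)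

  mark-second : mark a b high low b ≡ high
  mark-second with b ≟ a | b ≟ b
  ... | yes _ | _       = refl
  ... | no  _ | yes _   = refl
  ... | no  _ | no  b≢b = ⊥-elim (b≢b refl)

  mark-other : ∀ {v} → v ≢ a → v ≢ b → mark a b high low v ≡ low
  mark-other {v} v≢a v≢b with v ≟ a | v ≟ b
  ... | no  _   | no  _   = refl
  ... | yes v≡a | _       = ⊥-elim (v≢a v≡a)
  ... | no  _   | yes v≡b = ⊥-elim (v≢b v≡b)

Avoids : ∀ {n} → Fin n → Fin n → Block n → Set
Avoids a b x = a ∉ blockVars x × b ∉ blockVars x

data Lone {n} (a b : Fin n) : Block n → Set where
  single : Lone a b (single a)
  left   : ∀ {c} → c ≢ a → c ≢ b → Lone a b (pair a c)
  right  : ∀ {c} → c ≢ a → c ≢ b → Lone a b (pair c a)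

Lone-∌ : ∀ {n} {a b : Fin n} {x} → a ≢ b → Lone a b x → b ∉ blockVars x
Lone-∌ a≢b single          (here b≡a)         = a≢b (sym b≡a)
Lone-∌ a≢b (left  _ c≢b)   (here b≡a)         = a≢b (sym b≡a)
Lone-∌ a≢b (left  _ c≢b)   (there (here b≡c)) = c≢b (sym b≡c)
Lone-∌ a≢b (right _ c≢b)   (here b≡c)         = c≢b (sym b≡c)
Lone-∌ a≢b (right _ c≢b)   (there (here b≡a)) = a≢b (sym b≡a)

data PairView {n} (a b : Fin n) (L : List (Block n)) : Set where
  together : ∀ {x R} → L ↭ x ∷ R → x ≡ pair a b ⊎ x ≡ pair b a → All (Avoids a b) R → PairView a b L
  apart    : ∀ {x y R} → L ↭ x ∷ y ∷ R → Lone a b x → Lone b a y → All (Avoids a b) R → PairView a b L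

Unique-resp-↭ : ∀ {A : Set} {xs ys : List A} → xs ↭ ys → Unique xs → Unique ys
Unique-resp-↭ {A} p = PermProps.Unique-resp-↭ (setoid A) (↭⇒↭ₛ p)

Unique-++⁻ : ∀ {A : Set} (xs : List A) {ys} → Unique (xs ++ ys) →
             Unique xs × Unique ys × (∀ {v} → v ∈ xs → v ∉ ys)
Unique-++⁻ []       u         = [] , u , λ ()
Unique-++⁻ (x ∷ xs) (x∉ ∷ u) with Unique-++⁻ xs u
... | uxs , uys , disjoint = All.++⁻ˡ xs x∉ ∷ uxs , uys , λ
  { (here refl) v∈ys → All.lookup (All.++⁻ʳ xs x∉) v∈ys refl
  ; (there v∈xs)     → disjoint v∈xs }

classify : ∀ {n} {a b : Fin n} {x} → Unique (blockVars x) → a ∈ blockVars x →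
           (x ≡ pair a b ⊎ x ≡ pair b a) ⊎ Lone a b x
classify {x = single _} _ (here refl) = inj₂ single
classify {b = b} {pair _ c} ((a≢c ∷ []) ∷ _) (here refl) with c ≟ b
... | yes refl = inj₁ (inj₁ refl)
... | no  c≢b  = inj₂ (left (a≢c ∘ sym) c≢b)
classify {b = b} {pair c _} ((c≢a ∷ []) ∷ _) (there (here refl)) with c ≟ b
... | yes refl = inj₁ (inj₂ refl)
... | no  c≢b  = inj₂ (right c≢a c≢b)

∈-pairBlock : ∀ {n} {a b : Fin n} {x} → x ≡ pair a b ⊎ x ≡ pair b a → a ∈ blockVars x × b ∈ blockVars x
∈-pairBlock (inj₁ refl) = here refl , there (here refl)
∈-pairBlock (inj₂ refl) = there (here refl) , here refl

avoids : ∀ {n} {a b : Fin n} R → a ∉ vars R → b ∉ vars R → All (Avoids a b) R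
avoids []      _  _  = []
avoids (x ∷ R) a∉ b∉ =
  (a∉ ∘ ∈-++⁺ˡ , b∉ ∘ ∈-++⁺ˡ) ∷
  avoids R (a∉ ∘ ∈-++⁺ʳ (blockVars x)) (b∉ ∘ ∈-++⁺ʳ (blockVars x))

pairView : ∀ {n} {a b : Fin n} {L} → a ≢ b → Unique (vars L) → a ∈ vars L → b ∈ vars L → PairView a b L
pairView {a = a} {b} {L} a≢b u a∈ b∈ with blockOf L a∈
... | x , R , L↭ , a∈x with Unique-++⁻ (blockVars x) (Unique-resp-↭ (vars-↭ L↭) u)
...   | ux , uR , a∉R with classify ux a∈x
...     | inj₁ x≡ab = together L↭ x≡ab (avoids R (a∉R a∈x) (a∉R (proj₂ (∈-pairBlock x≡ab))))
...     | inj₂ lone with ∈-++⁻ (blockVars x) (∈-resp-↭ (vars-↭ L↭) b∈)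
...       | inj₁ b∈x = ⊥-elim (Lone-∌ a≢b lone b∈x)
...       | inj₂ b∈R with blockOf R b∈R
...         | y , R′ , R↭ , b∈y with Unique-++⁻ (blockVars y) (Unique-resp-↭ (vars-↭ R↭) uR)
...           | uy , _ , b∉R′ with classify uy b∈y
...             | inj₁ y≡ba =
  ⊥-elim (a∉R a∈x (∈-resp-↭ (↭-sym (vars-↭ R↭)) (∈-++⁺ˡ (proj₂ (∈-pairBlock y≡ba)))))
...             | inj₂ lone′ =
  apart (↭-trans L↭ (prep x R↭)) lone lone′
        (avoids R′ (a∉R a∈x ∘ ∈-resp-↭ (↭-sym (vars-↭ R↭)) ∘ ∈-++⁺ʳ (blockVars y)) (b∉R′ b∈y))

together-pairIn : ∀ {n} {a b : Fin n} {L x R} → L ↭ x ∷ R → x ≡ pair a b ⊎ x ≡ pair b a → PairIn a b L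
together-pairIn L↭ (inj₁ refl) = inj₁ (∈-resp-↭ (↭-sym L↭) (here refl))
together-pairIn L↭ (inj₂ refl) = inj₂ (∈-resp-↭ (↭-sym L↭) (here refl))

apart-¬pairIn : ∀ {n} {a b : Fin n} {L x y R} → a ≢ b → L ↭ x ∷ y ∷ R → Lone a b x → Lone b a y →
                All (Avoids a b) R → ¬ PairIn a b L
apart-¬pairIn {a = a} {b} {x = x} {y} {R} a≢b L↭ lone-x lone-y avoid = excluded ∘ PairIn-resp-↭ L↭
  where
  b∉x : b ∉ blockVars x
  b∉x = Lone-∌ a≢b lone-x

  a∉y : a ∉ blockVars y
  a∉y = Lone-∌ (a≢b ∘ sym) lone-y

  not-pair : ∀ {u w z} → u ∉ blockVars z ⊎ w ∉ blockVars z → pair u w ≢ z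
  not-pair (inj₁ u∉) refl = u∉ (here refl)
  not-pair (inj₂ w∉) refl = w∉ (there (here refl))

  excluded : ¬ PairIn a b (x ∷ y ∷ R)
  excluded (inj₁ (here ab≡x))          = not-pair (inj₂ b∉x) ab≡x
  excluded (inj₂ (here ba≡x))          = not-pair (inj₁ b∉x) ba≡x
  excluded (inj₁ (there (here ab≡y)))  = not-pair (inj₁ a∉y) ab≡y
  excluded (inj₂ (there (here ba≡y)))  = not-pair (inj₂ a∉y) ba≡y
  excluded (inj₁ (there (there ab∈R))) = proj₁ (All.lookup avoid ab∈R) (here refl)
  excluded (inj₂ (there (there ba∈R))) = proj₁ (All.lookup avoid ba∈R) (there (here refl))

module _ {G : Set} (_∙_ : G → G → G) {n} {a b : Fin n} (high low : G) where

  private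
    value : Block n → G
    value = evalBlock _∙_ (mark a b high low)

  avoids-value : ∀ {x} → Avoids a b x → value x ≡ low ⊎ value x ≡ low ∙ low
  avoids-value {single v} (a∉ , b∉) = inj₁ (mark-other a b high low (a∉ ∘ here ∘ sym) (b∉ ∘ here ∘ sym))
  avoids-value {pair u v} (a∉ , b∉) = inj₂ (cong₂ _∙_
    (mark-other a b high low (a∉ ∘ here ∘ sym) (b∉ ∘ here ∘ sym))
    (mark-other a b high low (a∉ ∘ there ∘ here ∘ sym) (b∉ ∘ there ∘ here ∘ sym)))

  together-value : ∀ {x} → x ≡ pair a b ⊎ x ≡ pair b a → value x ≡ high ∙ high
  together-value (inj₁ refl) = cong₂ _∙_ (mark-first a b high low) (mark-second a b high low)
  together-value (inj₂ refl) = cong₂ _∙_ (mark-second a b high low) (mark-first a b high low)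

  lone-value : ∀ {u w x} → mark a b high low u ≡ high →
               (∀ {c} → c ≢ u → c ≢ w → mark a b high low c ≡ low) →
               Lone u w x → value x ≡ high ⊎ value x ≡ high ∙ low ⊎ value x ≡ low ∙ high
  lone-value mark-u _    single              = inj₁ mark-u
  lone-value mark-u lows (left  c≢u c≢w)     = inj₂ (inj₁ (cong₂ _∙_ mark-u (lows c≢u c≢w)))
  lone-value mark-u lows (right c≢u c≢w)     = inj₂ (inj₂ (cong₂ _∙_ (lows c≢u c≢w) mark-u))

  lone-value₁ : ∀ {x} → Lone a b x → value x ≡ high ⊎ value x ≡ high ∙ low ⊎ value x ≡ low ∙ high
  lone-value₁ = lone-value (mark-first a b high low) (mark-other a b high low)

  lone-value₂ : ∀ {x} → Lone b a x → value x ≡ high ⊎ value x ≡ high ∙ low ⊎ value x ≡ low ∙ high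
  lone-value₂ = lone-value (mark-second a b high low) (λ c≢b c≢a → mark-other a b high low c≢a c≢b)

record PairDetector {G : Set} (_∙_ : G → G → G) : Set where
  field
    high low target : G
    together-target : ∀ {n} {a b c d : Fin n} {L x R} → pair c d ∷ L ↭ x ∷ R →
                      x ≡ pair a b ⊎ x ≡ pair b a → All (Avoids a b) R →
                      evalFlat _∙_ (mark a b high low) (node c d L) ≡ target
    apart-target    : ∀ {n} {a b c d : Fin n} {L x y R} → pair c d ∷ L ↭ x ∷ y ∷ R →
                      Lone a b x → Lone b a y → All (Avoids a b) R →
                      evalFlat _∙_ (mark a b high low) (node c d L) ≢ target

  detects : ∀ {n} {a b c d : Fin n} {L} → a ≢ b → vars (pair c d ∷ L) ↭ allFin n →
            (PairIn a b (pair c d ∷ L) → evalFlat _∙_ (mark a b high low) (node c d L) ≡ target) ×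
            (¬ PairIn a b (pair c d ∷ L) → evalFlat _∙_ (mark a b high low) (node c d L) ≢ target)
  detects {a = a} {b} a≢b partition
    with pairView a≢b (Unique-resp-↭ (↭-sym partition) (allFin⁺ _))
                      (∈-resp-↭ (↭-sym partition) (∈-allFin a)) (∈-resp-↭ (↭-sym partition) (∈-allFin b))
  ... | together L↭ x≡ab avoid =
    (λ _ → together-target L↭ x≡ab avoid) , (λ ∉ → ⊥-elim (∉ (together-pairIn L↭ x≡ab)))
  ... | apart L↭ lone-x lone-y avoid =
    (λ ∈ → ⊥-elim (apart-¬pairIn a≢b L↭ lone-x lone-y avoid ∈)) ,
    (λ _ → apart-target L↭ lone-x lone-y avoid)

CanonSeparated : {G : Set} → (G → G → G) → ℕ → Set
CanonSeparated _∙_ n = ∀ (m m′ : Matching (suc n)) → m ≢ singles _ → m′ ≢ singles _ → m ≢ m′ →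
                       ¬ SameOp _∙_ (canon m) (canon m′)

module _ {G : Set} {_∙_ : G → G → G} (comm : Commutative _∙_) (ii : Ident-ii _∙_)
         (detector : PairDetector _∙_) where
  open Normalization comm ii
  open PairDetector detector

  canon-detects : ∀ {n} (m : Matching (suc n)) → m ≢ singles _ → ∀ {a b} → a ≢ b →
                  (PairIn a b (blocks m) → eval _∙_ (mark a b high low) (canon m) ≡ target) ×
                  (¬ PairIn a b (blocks m) → eval _∙_ (mark a b high low) (canon m) ≢ target)
  canon-detects m m≢singles {a} {b} a≢b with flatten-canon m (nontrivial⇒pair m m≢singles)
  ... | c , d , M , flat≡ , perm with detects a≢b (↭-trans (vars-↭ perm) (vars-blocks m))
  ...   | yes-pair , no-pair =
    (λ p → trans value≡ (yes-pair (PairIn-resp-↭ (↭-sym perm) p))) ,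
    (λ ¬p → no-pair (¬p ∘ PairIn-resp-↭ perm) ∘ trans (sym value≡))
    where
    value≡ : eval _∙_ (mark a b high low) (canon m) ≡ evalFlat _∙_ (mark a b high low) (node c d M)
    value≡ = trans (eval-flatten _ (canon m)) (cong (evalFlat _∙_ _) flat≡)

  detector-separates : ∀ {n} → CanonSeparated _∙_ n
  detector-separates m m′ m≢s m′≢s m≢m′ same with extraPair m m′ m≢m′
  ... | inj₁ (a , b , a≢b , ab∈ , ab∉) =
    proj₂ (canon-detects m′ m′≢s a≢b) ab∉
          (trans (sym (same _)) (proj₁ (canon-detects m m≢s a≢b) (inj₁ ab∈)))
  ... | inj₂ (a , b , a≢b , ab∈ , ab∉) =
    proj₂ (canon-detects m m≢s a≢b) ab∉
          (trans (same _) (proj₁ (canon-detects m′ m′≢s a≢b) (inj₁ ab∈)))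

module _ {G : Set} (_∙_ : G → G → G) {n : ℕ} (separated : CanonSeparated _∙_ (suc n)) where

  fullLinear-lower : SpecGe _∙_ (suc (suc n)) IsFullLinear (B2 (suc (suc n)) ∸ 1)
  fullLinear-lower =
    subst (λ k → SpecGe _∙_ (suc (suc n)) IsFullLinear (k ∸ 1)) (sym (B2≡pairings (suc (suc n))))
      (specGe-enumeration _∙_ IsFullLinear (fullLinearCanon (suc n)) (canon-fullLinear ∘ nontrivial) distinct)
    where
    open Enumeration suc (suc (suc n))
    distinct : ∀ i j → i ≢ j → ¬ SameOp _∙_ (fullLinearCanon (suc n) i) (fullLinearCanon (suc n) j)
    distinct i j i≢j = separated (nontrivial i) (nontrivial j) (nontrivial≢singles i) (nontrivial≢singles j)
                                 (i≢j ∘ nontrivial-injective i j)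

  bracketing-lower : SpecGe _∙_ (suc (suc n)) IsBracketing (fib (suc (suc (suc n))) ∸ 1)
  bracketing-lower =
    subst (λ k → SpecGe _∙_ (suc (suc n)) IsBracketing (k ∸ 1)) (sym (fib≡pairings (suc (suc n))))
      (specGe-enumeration _∙_ IsBracketing (bracketingCanon (suc n)) (canon-bracketing ∘ nontrivial) distinct)
    where
    open Enumeration (λ _ → 1) (suc (suc n))
    embed≢singles : ∀ {q} → q ≢ singles (suc (suc n)) → embed q ≢ singles (suc (suc n))
    embed≢singles {q} q≢singles eq =
      q≢singles (embed-injective {q = q} {singles (suc (suc n))} (trans eq (sym (embed-singles (suc (suc n))))))
    distinct : ∀ i j → i ≢ j → ¬ SameOp _∙_ (bracketingCanon (suc n) i) (bracketingCanon (suc n) j)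
    distinct i j i≢j = separated (embed (nontrivial i)) (embed (nontrivial j))
                                 (embed≢singles (nontrivial≢singles i)) (embed≢singles (nontrivial≢singles j))
                                 (i≢j ∘ nontrivial-injective i j ∘ embed-injective {q = nontrivial i} {nontrivial j})

injective⇒surjective : ∀ {k} (f : Fin k → Fin k) → (∀ {i j} → f i ≡ f j → i ≡ j) →
                       ∀ y → ∃ λ i → f i ≡ y
injective⇒surjective {suc k} f f-inj y with any? (λ i → f i ≟ y)
... | yes hit = hit
... | no  miss with pigeonhole (n<1+n k) (λ i → punchOut {i = y} {j = f i} (miss ∘ (i ,_) ∘ sym))
...   | i , j , i<j , eq =
  ⊥-elim (<-irrefl (f-inj (punchOut-injective (miss ∘ (i ,_) ∘ sym) (miss ∘ (j ,_) ∘ sym) eq)) i<j)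

-- B2 n - 1 pairwise distinct operations of full linear terms must all be operations of
-- canonical terms, so the map to the covering canonical term is a bijection.
module _ {G : Set} {_∙_ : G → G → G} (comm : Commutative _∙_) (ii : Ident-ii _∙_) where
  open UpperBounds comm ii

  module Tight {n : ℕ} (v : Vec (Term (suc (suc n))) (pairings suc (suc (suc n)) ∸ 1))
               (v-fl : VAll.All IsFullLinear v)
               (v-distinct : ∀ i j → i ≢ j → ¬ SameOp _∙_ (lookup v i) (lookup v j)) where
    open Enumeration suc (suc (suc n))

    index : Fin (pairings suc (suc (suc n)) ∸ 1) → Fin (pairings suc (suc (suc n)) ∸ 1)
    index i = proj₁ (fullLinear-covered (lookup v i) (VAll.lookup⁺ v-fl i))

    index-sameOp : ∀ i → SameOp _∙_ (lookup v i) (fullLinearCanon (suc n) (index i))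
    index-sameOp i = proj₂ (fullLinear-covered (lookup v i) (VAll.lookup⁺ v-fl i))

    index-injective : ∀ {i j} → index i ≡ index j → i ≡ j
    index-injective {i} {j} eq = decidable-stable (i ≟ j) λ i≢j → v-distinct i j i≢j λ ρ → begin
      eval _∙_ ρ (lookup v i)                            ≡⟨ index-sameOp i ρ ⟩
      eval _∙_ ρ (fullLinearCanon (suc n) (index i))     ≡⟨ cong (eval _∙_ ρ ∘ fullLinearCanon (suc n)) eq ⟩
      eval _∙_ ρ (fullLinearCanon (suc n) (index j))     ≡⟨ index-sameOp j ρ ⟨
      eval _∙_ ρ (lookup v j)                            ∎
      where open ≡-Reasoning

    source : ∀ m → m ≢ singles _ → ∃ λ i → nontrivial (index i) ≡ m
    source m m≢singles =
      let c , c↦m = nontrivial-surjective m m≢singles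
          i , i↦c = injective⇒surjective index index-injective c
      in i , trans (cong nontrivial i↦c) c↦m

    separated : CanonSeparated _∙_ (suc n)
    separated m m′ m≢s m′≢s m≢m′ same = v-distinct i i′ i≢i′ λ ρ → begin
      eval _∙_ ρ (lookup v i)     ≡⟨ index-sameOp i ρ ⟩
      eval _∙_ ρ (canon (nontrivial (index i)))   ≡⟨ cong (eval _∙_ ρ ∘ canon) i↦m ⟩
      eval _∙_ ρ (canon m)        ≡⟨ same ρ ⟩
      eval _∙_ ρ (canon m′)       ≡⟨ cong (eval _∙_ ρ ∘ canon) i′↦m′ ⟨
      eval _∙_ ρ (canon (nontrivial (index i′)))  ≡⟨ index-sameOp i′ ρ ⟨
      eval _∙_ ρ (lookup v i′)    ∎
      where
      open ≡-Reasoning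
      i i′ : Fin (pairings suc (suc (suc n)) ∸ 1)
      i  = proj₁ (source m m≢s)
      i′ = proj₁ (source m′ m′≢s)

      i↦m : nontrivial (index i) ≡ m
      i↦m = proj₂ (source m m≢s)

      i′↦m′ : nontrivial (index i′) ≡ m′
      i′↦m′ = proj₂ (source m′ m′≢s)
      i≢i′ : i ≢ i′
      i≢i′ i≡i′ = m≢m′ (trans (sym i↦m) (trans (cong (nontrivial ∘ index) i≡i′) i′↦m′))

  fullLinear-tight⇒separated : ∀ {n} → SpecGe _∙_ (suc (suc n)) IsFullLinear (B2 (suc (suc n)) ∸ 1) →
                               CanonSeparated _∙_ (suc n)
  fullLinear-tight⇒separated {n} tight =
    let v , v-fl , v-distinct =
          subst (λ k → SpecGe _∙_ (suc (suc n)) IsFullLinear (k ∸ 1)) (B2≡pairings (suc (suc n))) tight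
    in Tight.separated v v-fl v-distinct

sc79-comm : Commutative sc79
sc79-comm = toWitness {a? = all? λ x → all? λ y → sc79 x y ≟ sc79 y x} tt

sc79-ii : Ident-ii sc79
sc79-ii = toWitness {a? = all? λ w → all? λ x → all? λ y → all? λ z →
                           sc79 (sc79 (sc79 w x) y) z ≟ sc79 (sc79 (sc79 w x) z) y} tt

sc79≢2 : ∀ x y → sc79 x y ≢ 2F
sc79≢2 = toWitness {a? = all? λ x → all? λ y → ¬? (sc79 x y ≟ 2F)} tt

sc79≡1 : ∀ x y → x ≢ 2F → sc79 x y ≡ 1F → x ≡ 1F × y ≡ 1F
sc79≡1 1F 1F _   _  = refl , refl
sc79≡1 2F _  x≢2 _  = ⊥-elim (x≢2 refl)
sc79≡1 0F _  _   ()
sc79≡1 1F 0F _   ()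
sc79≡1 1F 2F _   ()

foldl-sc79≡1 : ∀ {h} xs → h ≡ 1F → All (_≡ 1F) xs → foldl sc79 h xs ≡ 1F
foldl-sc79≡1 []       h≡1  []            = h≡1
foldl-sc79≡1 (_ ∷ xs) refl (refl ∷ xs≡1) = foldl-sc79≡1 xs refl xs≡1

foldl-sc79≡1⁻ : ∀ h xs → h ≢ 2F → foldl sc79 h xs ≡ 1F → All (_≡ 1F) (h ∷ xs)
foldl-sc79≡1⁻ h []       _   h≡1 = h≡1 ∷ []
foldl-sc79≡1⁻ h (x ∷ xs) h≢2 eq with foldl-sc79≡1⁻ (sc79 h x) xs (sc79≢2 h x) eq
... | hx≡1 ∷ xs≡1 = proj₁ (sc79≡1 h x h≢2 hx≡1) ∷ proj₂ (sc79≡1 h x h≢2 hx≡1) ∷ xs≡1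

-- With x_a, x_b ↦ 2 and everything else ↦ 1, a block evaluates to 1 unless it separates a from b.
sc79-detector : PairDetector sc79
sc79-detector = record
  { high = 2F ; low = 1F ; target = 1F
  ; together-target = one
  ; apart-target = not-one
  }
  where
  one : ∀ {n} {a b c d : Fin n} {L x R} → pair c d ∷ L ↭ x ∷ R → x ≡ pair a b ⊎ x ≡ pair b a →
             All (Avoids a b) R → evalFlat sc79 (mark a b 2F 1F) (node c d L) ≡ 1F
  one {L = L} L↭ x≡ab avoid with All-resp-↭ (↭-sym L↭) (together-value sc79 2F 1F x≡ab ∷
                                      All.map (λ av → [ id , id ]′ (avoids-value sc79 2F 1F av)) avoid)
  ... | cd≡1 ∷ L≡1 = foldl-sc79≡1 (map _ L) cd≡1 (All.map⁺ L≡1)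

  not-one : ∀ {n} {a b c d : Fin n} {L x y R} → pair c d ∷ L ↭ x ∷ y ∷ R → Lone a b x → Lone b a y →
          All (Avoids a b) R → evalFlat sc79 (mark a b 2F 1F) (node c d L) ≢ 1F
  not-one {c = c} {d} {L} L↭ lone-x _ _ eq with All-resp-↭ L↭ (All.map⁻ (foldl-sc79≡1⁻ _ _ (sc79≢2 _ _) eq))
  ... | x≡1 ∷ _ = ≢1 (lone-value₁ sc79 2F 1F lone-x) x≡1
    where
    ≢1 : ∀ {v} → v ≡ 2F ⊎ v ≡ 0F ⊎ v ≡ 0F → v ≢ 1F
    ≢1 (inj₁ refl)        ()
    ≢1 (inj₂ (inj₁ refl)) ()
    ≢1 (inj₂ (inj₂ refl)) ()

sc1701-comm : Commutative sc1701
sc1701-comm = toWitness {a? = all? λ x → all? λ y → sc1701 x y ≟ sc1701 y x} tt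

sc1701-ii : Ident-ii sc1701
sc1701-ii = toWitness {a? = all? λ w → all? λ x → all? λ y → all? λ z →
                               sc1701 (sc1701 (sc1701 w x) y) z ≟ sc1701 (sc1701 (sc1701 w x) z) y} tt

sc1701≢2 : ∀ x y → sc1701 x y ≢ 2F
sc1701≢2 = toWitness {a? = all? λ x → all? λ y → ¬? (sc1701 x y ≟ 2F)} tt

foldl-sc1701≢2 : ∀ h xs → h ≢ 2F → foldl sc1701 h xs ≢ 2F
foldl-sc1701≢2 h []       h≢2 = h≢2
foldl-sc1701≢2 h (x ∷ xs) _   = foldl-sc1701≢2 (sc1701 h x) xs (sc1701≢2 h x)

nonzero : Fin 3 → Bool
nonzero 0F = false
nonzero _  = true

nonzero-sc1701 : ∀ x y → x ≢ 2F → nonzero (sc1701 x y) ≡ nonzero x xor nonzero y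
nonzero-sc1701 2F _  x≢2 = ⊥-elim (x≢2 refl)
nonzero-sc1701 0F 0F _   = refl
nonzero-sc1701 0F 1F _   = refl
nonzero-sc1701 0F 2F _   = refl
nonzero-sc1701 1F 0F _   = refl
nonzero-sc1701 1F 1F _   = refl
nonzero-sc1701 1F 2F _   = refl

xorAll : List Bool → Bool
xorAll = foldr _xor_ false

xorAll-↭ : ∀ {bs cs} → bs ↭ cs → xorAll bs ≡ xorAll cs
xorAll-↭ bs↭cs = PermProps.foldr-commMonoid (setoid Bool)
                   (CommutativeRing.+-isCommutativeMonoid xor-∧-commutativeRing) (↭⇒↭ₛ bs↭cs)

xorAll-false : ∀ {bs} → All (_≡ false) bs → xorAll bs ≡ false
xorAll-false []           = refl
xorAll-false (refl ∷ bs≡) = xorAll-false bs≡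

nonzero-foldl-sc1701 : ∀ h xs → h ≢ 2F → nonzero (foldl sc1701 h xs) ≡ xorAll (map nonzero (h ∷ xs))
nonzero-foldl-sc1701 h []       _   = sym (xor-identityʳ (nonzero h))
nonzero-foldl-sc1701 h (x ∷ xs) h≢2 = begin
  nonzero (foldl sc1701 (sc1701 h x) xs)                    ≡⟨ nonzero-foldl-sc1701 (sc1701 h x) xs (sc1701≢2 h x) ⟩
  nonzero (sc1701 h x) xor xorAll (map nonzero xs)          ≡⟨ cong (_xor xorAll (map nonzero xs)) (nonzero-sc1701 h x h≢2) ⟩
  (nonzero h xor nonzero x) xor xorAll (map nonzero xs)     ≡⟨ xor-assoc (nonzero h) (nonzero x) _ ⟩
  nonzero h xor (nonzero x xor xorAll (map nonzero xs))     ∎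
  where open ≡-Reasoning

module _ {n} (a b : Fin n) where

  private
    bit : Block n → Bool
    bit = nonzero ∘ evalBlock sc1701 (mark a b 2F 0F)

  sc1701-parity : ∀ c d L {M} → pair c d ∷ L ↭ M →
                  nonzero (evalFlat sc1701 (mark a b 2F 0F) (node c d L)) ≡ xorAll (map bit M)
  sc1701-parity c d L {M} L↭ = begin
    nonzero (evalFlat sc1701 (mark a b 2F 0F) (node c d L))
      ≡⟨ nonzero-foldl-sc1701 _ (map value L) (sc1701≢2 _ _) ⟩
    xorAll (map nonzero (map value (pair c d ∷ L)))
      ≡⟨ cong xorAll (map-∘ {g = nonzero} {f = value} (pair c d ∷ L)) ⟨
    xorAll (map bit (pair c d ∷ L))
      ≡⟨ xorAll-↭ (map⁺ bit L↭) ⟩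
    xorAll (map bit M)
      ∎
    where
    open ≡-Reasoning
    value : Block n → Fin 3
    value = evalBlock sc1701 (mark a b 2F 0F)

  sc1701-avoiders : ∀ {R} → All (Avoids a b) R → xorAll (map bit R) ≡ false
  sc1701-avoiders avoid =
    xorAll-false (All.map⁺ (All.map (λ av → cong nonzero ([ id , id ]′ (avoids-value sc1701 2F 0F av))) avoid))

lone-nonzero : ∀ {v} → v ≡ 2F ⊎ v ≡ sc1701 2F 0F ⊎ v ≡ sc1701 0F 2F → nonzero v ≡ true
lone-nonzero (inj₁ refl)        = refl
lone-nonzero (inj₂ (inj₁ refl)) = refl
lone-nonzero (inj₂ (inj₂ refl)) = refl

-- With x_a, x_b ↦ 2 and everything else ↦ 0, a block has a nonzero value exactly when it
-- meets {a, b}, so the parity of a comb counts its blocks meeting {a, b}.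
sc1701-detector : PairDetector sc1701
sc1701-detector = record
  { high = 2F ; low = 0F ; target = 1F
  ; together-target = one
  ; apart-target = not-one
  }
  where
  one : ∀ {n} {a b c d : Fin n} {L x R} → pair c d ∷ L ↭ x ∷ R → x ≡ pair a b ⊎ x ≡ pair b a →
        All (Avoids a b) R → evalFlat sc1701 (mark a b 2F 0F) (node c d L) ≡ 1F
  one {a = a} {b} {c} {d} {L} L↭ x≡ab avoid =
    nonzero≡true (foldl-sc1701≢2 _ (map (evalBlock sc1701 (mark a b 2F 0F)) L) (sc1701≢2 _ _))
      (trans (sc1701-parity a b c d L L↭)
             (cong₂ (λ u v → nonzero u xor v) (together-value sc1701 2F 0F x≡ab) (sc1701-avoiders a b avoid)))
    where
    nonzero≡true : ∀ {v} → v ≢ 2F → nonzero v ≡ true → v ≡ 1F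
    nonzero≡true {1F} _   _ = refl
    nonzero≡true {2F} v≢2 _ = ⊥-elim (v≢2 refl)

  not-one : ∀ {n} {a b c d : Fin n} {L x y R} → pair c d ∷ L ↭ x ∷ y ∷ R → Lone a b x → Lone b a y →
            All (Avoids a b) R → evalFlat sc1701 (mark a b 2F 0F) (node c d L) ≢ 1F
  not-one {a = a} {b} {c} {d} {L} L↭ lone-x lone-y avoid eq
    with trans (sym (cong nonzero eq)) (sc1701-parity a b c d L L↭)
  ... | true≡ rewrite lone-nonzero (lone-value₁ sc1701 2F 0F lone-x)
                    | lone-nonzero (lone-value₂ sc1701 2F 0F lone-y)
                    | sc1701-avoiders a b avoid = case true≡ of λ ()

module _ {G : Set} {_∙_ : G → G → G} (comm : Commutative _∙_) (ii : Ident-ii _∙_) where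
  open UpperBounds comm ii

  fullLinear-tight⇒bracketing-tight : ∀ n → SpecEq _∙_ (suc (suc n)) IsFullLinear (B2 (suc (suc n)) ∸ 1) →
                                      SpecEq _∙_ (suc (suc n)) IsBracketing (fib (suc (suc (suc n))) ∸ 1)
  fullLinear-tight⇒bracketing-tight n (_ , tight) =
    bracketing-upper n , bracketing-lower _∙_ (fullLinear-tight⇒separated comm ii tight)

  detector-tight : PairDetector _∙_ → ∀ n →
                   SpecEq _∙_ (suc (suc n)) IsBracketing (fib (suc (suc (suc n))) ∸ 1) ×
                   SpecEq _∙_ (suc (suc n)) IsFullLinear (B2 (suc (suc n)) ∸ 1)
  detector-tight detector n =
    (bracketing-upper n , bracketing-lower _∙_ separated) , (fullLinear-upper n , fullLinear-lower _∙_ separated)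
    where
    separated : ∀ {k} → CanonSeparated _∙_ k
    separated = detector-separates comm ii detector

from-two : {P : ℕ → Set} → (∀ n → P (suc (suc n))) → ∀ n → 2 ≤ n → P n
from-two p (suc zero)    (s≤s ())
from-two p (suc (suc n)) _ = p n

proposition5p2 :
    ((G : Set) (_∙_ : G → G → G) → Commutative _∙_ → Ident-ii _∙_ →
      ∀ n → 2 ≤ n →
        SpecLe _∙_ n IsBracketing (fib (suc n) ∸ 1)
        × SpecLe _∙_ n IsFullLinear (B2 n ∸ 1)
        × (SpecEq _∙_ n IsFullLinear (B2 n ∸ 1) →
           SpecEq _∙_ n IsBracketing (fib (suc n) ∸ 1)))
    × (Commutative sc79 × Ident-ii sc79 ×
       (∀ n → 2 ≤ n →
          SpecEq sc79 n IsBracketing (fib (suc n) ∸ 1)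
          × SpecEq sc79 n IsFullLinear (B2 n ∸ 1)))
    × (Commutative sc1701 × Ident-ii sc1701 ×
       (∀ n → 2 ≤ n →
          SpecEq sc1701 n IsBracketing (fib (suc n) ∸ 1)
          × SpecEq sc1701 n IsFullLinear (B2 n ∸ 1)))
proposition5p2 =
  (λ G _∙_ comm ii → from-two λ n →
     UpperBounds.bracketing-upper comm ii n ,
     UpperBounds.fullLinear-upper comm ii n ,
     fullLinear-tight⇒bracketing-tight comm ii n)
  , (sc79-comm , sc79-ii , from-two (detector-tight sc79-comm sc79-ii sc79-detector))
  , (sc1701-comm , sc1701-ii , from-two (detector-tight sc1701-comm sc1701-ii sc1701-detector))
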